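{- Let $n\ge1$, let $E_n = \wedge\{\alpha_1,\dots,\alpha_n,\theta_1,\dots,\theta_n\}$ be the exterior algebra over $\mathbb{C}$ bigraded by $(E_n)_{i,j} = \wedge^i\{\alpha_1,\dots,\alpha_n\}\otimes\wedge^j\{\theta_1,\dots,\theta_n\}$, let $T:E_n\to E_n$ be the algebra homomorphism with $T(\theta_i)=\theta_i+\alpha_i$, $T(\alpha_i)=\alpha_i$, and let $\tau(f)=\sum_{i=1}^n\alpha_i\cdot(\partial/\partial\theta_i)f$. Then $\{T(f)-f : f\in E_n\}$ equals the image of $\tau:E_n\to E_n$. Consequently $H^1(M,\mathcal{O}) := E_n/\{T(f)-f: f\in E_n\}$ is the cokernel of the bihomogeneous map $\tau$, and in particular is bigraded: $H^1(M,\mathcal{O})=\bigoplus_{i,j=0}^n H^1(M,\mathcal{O})_{i,j}$ with $H^1(M,\mathcal{O})_{i,j} = (E_n)_{i,j}/\tau((E_n)_{i-1,j+1})$.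
   Context: The fermionic derivative $\partial/\partial\theta_i$ on $E_n$ is the linear extension of $\partial/\partial\omega_i(\omega_{j_1}\cdots\omega_{j_r}) = (-1)^{s-1}\omega_{j_1}\cdots\widehat{\omega_{j_s}}\cdots\omega_{j_r}$ if $\omega_{j_s}=\theta_i$, and $0$ if $\theta_i$ does not occur, for monomials in distinct generators $\omega_{j_1},\dots,\omega_{j_r}$ of $E_n$. The operator $\tau$ has bidegree $(1,-1)$. -}

module Defs where

open import Level using (_⊔_) renaming (suc to lsuc)
open import Algebra.Bundles using (CommutativeRing)
open import Data.Nat as ℕ using (ℕ; zero; suc)
open import Data.Nat.Properties using () renaming (_≟_ to _≟ℕ_)
open import Data.Bool using (Bool; true; false; if_then_else_)
open import Data.Vec using (Vec; []; _∷_; take; drop; lookup; _[_]≔_)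
open import Data.Vec.Properties using (≡-dec)
open import Data.Fin using (Fin; zero; suc; _↑ˡ_; _↑ʳ_)
open import Data.Fin.Subset using (Subset; ⁅_⁆; ⊥)
open import Data.Product using (Σ; _×_)
open import Data.Sum using (inj₁; inj₂)
open import Relation.Nullary using (¬_; does)
open import Relation.Binary.PropositionalEquality using (_≡_)

-- Fields of characteristic zero (ℂ is one; stdlib has no ℂ).

module _ {c ℓ} (R : CommutativeRing c ℓ) where
  open CommutativeRing R
  natCast : ℕ → Carrier
  natCast zero = 0#
  natCast (suc k) = 1# + natCast k

record Char0Field c ℓ : Set (lsuc (c ⊔ ℓ)) where
  field
    cring : CommutativeRing c ℓ
  open CommutativeRing cring hiding (zero)
  field
    1≉0 : ¬ (1# ≈ 0#)
    inverse : ∀ x → ¬ (x ≈ 0#) → Σ Carrier (λ y → (x * y) ≈ 1#)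
    char0 : ∀ k → ¬ (natCast cring (suc k) ≈ 0#)

-- Exterior algebra on m ordered generators ω_0 < … < ω_{m-1}:
-- an element is its coefficient function on the basis monomials
-- e_S = ω_{s_1} ⋯ ω_{s_r} (s_1 < ⋯ < s_r, S = {s_1,…,s_r}).

card : ∀ {m} → Subset m → ℕ
card [] = 0
card (true ∷ S) = suc (card S)
card (false ∷ S) = card S

below : ∀ {m} → Fin m → Subset m → ℕ
below zero _ = 0
below (suc i) (true ∷ S) = suc (below i S)
below (suc i) (false ∷ S) = below i S

module Exterior {c ℓ} (F : Char0Field c ℓ) where
  open Char0Field F
  open CommutativeRing cring hiding (zero)

  signed : ℕ → Carrier → Carrier
  signed zero x = x
  signed (suc k) x = - (signed k x)

  Ext : ℕ → Set c
  Ext m = Subset m → Carrier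

  _≈E_ : ∀ {m} → Ext m → Ext m → Set ℓ
  f ≈E g = ∀ W → f W ≈ g W

  0E : ∀ {m} → Ext m
  0E _ = 0#

  _+E_ : ∀ {m} → Ext m → Ext m → Ext m
  (f +E g) W = f W + g W

  _-E_ : ∀ {m} → Ext m → Ext m → Ext m
  (f -E g) W = f W - g W

  _·E_ : ∀ {m} → Carrier → Ext m → Ext m
  (a ·E f) W = a * f W

  sumSub : ∀ {m} → (Subset m → Carrier) → Carrier
  sumSub {zero} f = f []
  sumSub {suc m} f = sumSub (λ S → f (false ∷ S)) + sumSub (λ S → f (true ∷ S))

  sumFin : ∀ {k m} → (Fin k → Ext m) → Ext m
  sumFin {zero} g = 0E
  sumFin {suc k} g = g zero +E sumFin (λ i → g (suc i))

  e : ∀ {m} → Subset m → Ext m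
  e S W = if does (≡-dec Data.Bool._≟_ S W) then 1# else 0#

  -- coefficient of e_W in e_S · e_U
  mulCoef : ∀ {m} → Subset m → Subset m → Subset m → Carrier
  mulCoef [] [] [] = 1#
  mulCoef (true ∷ S) (true ∷ U) (w ∷ W) = 0#
  mulCoef (false ∷ S) (false ∷ U) (false ∷ W) = mulCoef S U W
  mulCoef (false ∷ S) (false ∷ U) (true ∷ W) = 0#
  mulCoef (true ∷ S) (false ∷ U) (true ∷ W) = mulCoef S U W
  mulCoef (false ∷ S) (true ∷ U) (true ∷ W) = signed (card S) (mulCoef S U W)
  mulCoef (true ∷ S) (false ∷ U) (false ∷ W) = 0#
  mulCoef (false ∷ S) (true ∷ U) (false ∷ W) = 0#

  _∧_ : ∀ {m} → Ext m → Ext m → Ext m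
  (f ∧ g) W = sumSub (λ S → sumSub (λ U → (f S * g U) * mulCoef S U W))

  1E : ∀ {m} → Ext m
  1E = e ⊥

  gen : ∀ {m} → Fin m → Ext m
  gen k = e ⁅ k ⁆

  -- fermionic derivative ∂/∂ω_i (linear extension of the rule in the paper):
  -- ∂_i e_{W ∪ {i}} = (-1)^{#{j ∈ W, j < i}} e_W  (i ∉ W), ∂_i e_S = 0 if i ∉ S
  ∂ : ∀ {m} → Fin m → Ext m → Ext m
  ∂ i f W = if lookup W i then 0# else signed (below i W) (f (W [ i ]≔ true))

  prodOver : ∀ {m m'} → (Fin m → Ext m') → Subset m → Ext m'
  prodOver g [] = 1E
  prodOver g (true ∷ S) = g zero ∧ prodOver (λ k → g (suc k)) S
  prodOver g (false ∷ S) = prodOver (λ k → g (suc k)) S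

  -- E_n: generators α_1..α_n (positions 0..n-1) then θ_1..θ_n (n..2n-1)
  module En (n : ℕ) where
    E : Set c
    E = Ext (n ℕ.+ n)

    α : Fin n → E
    α i = gen (i ↑ˡ n)

    θ : Fin n → E
    θ i = gen (n ↑ʳ i)

    bideg : Subset (n ℕ.+ n) → ℕ × ℕ
    bideg S = card (take n S) Data.Product., card (drop n S)

    proj : ℕ → ℕ → E → E
    proj i j f W = if does (card (take n W) ≟ℕ i) Data.Bool.∧ does (card (drop n W) ≟ℕ j)
                   then f W else 0#

    Bihom : ℕ → ℕ → E → Set ℓ
    Bihom i j f = f ≈E proj i j f

    Tgen : Fin (n ℕ.+ n) → E
    Tgen k with Data.Fin.splitAt n k
    ... | inj₁ i = α i
    ... | inj₂ i = θ i +E α i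

    -- T: the algebra homomorphism extending Tgen; on the basis
    -- T(e_S) = ∏_{k ∈ S increasing} T(ω_k), extended linearly
    T : E → E
    T f W = sumSub (λ S → f S * prodOver Tgen S W)

    τ : E → E
    τ f = sumFin (λ i → α i ∧ ∂ (n ↑ʳ i) f)

{-# OPTIONS --safe #-}
-- τ = Σ αᵢ ∂/∂θᵢ is an even derivation with τ(θᵢ) = αᵢ and τ(αᵢ) = 0, hence T = exp τ; the
-- exponential is a finite sum because τ raises the α-degree, so τⁿ⁺¹ = 0, and it needs 1/j!, which is
-- where characteristic zero enters. Then T − 1 = τ φ(τ) with φ(x) = (eˣ − 1)/x, so im(T − 1) ⊆ im τ.
-- Conversely T − 1 = τ + τ² ψ(τ) with ψ(τ) commuting with τ, so
-- τᵏ⁺¹h = (T − 1)(τᵏh) − τᵏ⁺²(ψ(τ)h), and descending induction from τⁿ⁺¹ = 0 puts every τᵏ⁺¹h in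
-- im(T − 1). Finally the coefficient of e_W in τf only involves coefficients of f of bidegree one
-- step back, so τ intertwines the bigraded projections and its image is bigraded.

module Submission where

open import Defs
open import Algebra.Bundles using (CommutativeRing)
import Algebra.Properties.AbelianGroup as AbelianGroupProperties
import Algebra.Properties.CommutativeSemigroup as CommutativeSemigroupProperties
import Algebra.Properties.Ring as RingProperties
open import Data.Bool using (true; false; if_then_else_)
import Data.Bool as Bool
open import Data.Empty using (⊥-elim)
open import Data.Fin as Fin using (Fin; zero; suc; toℕ; _↑ˡ_; _↑ʳ_)
open import Data.Fin.Properties using (<⇒≢; <-cmp; ↑ʳ-injective; splitAt-↑ˡ; splitAt-↑ʳ; splitAt⁻¹-↑ˡ; splitAt⁻¹-↑ʳ)
import Data.Fin.Properties as Fin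
open import Data.Fin.Subset using (Subset; ⁅_⁆; ⊥)
open import Data.Nat as ℕ using (ℕ; zero; suc; _≤_; z≤n; s≤s)
open import Data.Nat.Properties using () renaming (_≟_ to _≟ℕ_)
import Data.Nat.Properties as ℕ
open import Data.Product using (Σ; _×_; _,_; proj₁; proj₂)
open import Data.Sum using (_⊎_; inj₁; inj₂)
open import Data.Vec using (Vec; []; _∷_; lookup; _[_]≔_; take; drop)
open import Data.Vec.Properties using (≡-dec; ∷-injectiveʳ; lookup-replicate; []≔-idempotent; []≔-commutes; []≔-lookup; lookup∘update; lookup∘update′)
open import Relation.Binary.Definitions using (tri<; tri≈; tri>)
open import Relation.Binary.PropositionalEquality as P using (_≡_; _≢_)
open import Relation.Nullary using (¬_; Dec; yes; no; does)
open import Relation.Nullary.Decidable using (dec-true; dec-false; _×-dec_)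

-- Subsets, positions and counting

[]≔-self : ∀ {A : Set} {m} (W : Vec A m) p {x} → lookup W p ≡ x → W [ p ]≔ x ≡ W
[]≔-self W p P.refl = []≔-lookup W p

below-[]≔-≥ : ∀ {m} (W : Subset m) p q x → q Fin.≤ p → below q (W [ p ]≔ x) ≡ below q W
below-[]≔-≥ (w ∷ W) p zero x _ = P.refl
below-[]≔-≥ (true ∷ W) (suc p) (suc q) x (s≤s q≤p) = P.cong suc (below-[]≔-≥ W p q x q≤p)
below-[]≔-≥ (false ∷ W) (suc p) (suc q) x (s≤s q≤p) = below-[]≔-≥ W p q x q≤p

below-[]≔-< : ∀ {m} (W : Subset m) p q → p Fin.< q → below q (W [ p ]≔ true) ≡ suc (below q (W [ p ]≔ false))
below-[]≔-< (w ∷ W) zero (suc q) _ = P.refl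
below-[]≔-< (true ∷ W) (suc p) (suc q) (s≤s p<q) = P.cong suc (below-[]≔-< W p q p<q)
below-[]≔-< (false ∷ W) (suc p) (suc q) (s≤s p<q) = below-[]≔-< W p q p<q

below-remove : ∀ {m} (W : Subset m) p q → p Fin.< q → lookup W p ≡ true → below q W ≡ suc (below q (W [ p ]≔ false))
below-remove W p q p<q p∈W = P.trans (P.cong (below q) (P.sym ([]≔-self W p p∈W))) (below-[]≔-< W p q p<q)

card-⊥ : ∀ m → card (⊥ {m}) ≡ 0
card-⊥ zero = P.refl
card-⊥ (suc m) = card-⊥ m

card-⁅⁆ : ∀ {m} (k : Fin m) → card ⁅ k ⁆ ≡ 1
card-⁅⁆ {suc m} zero = P.cong suc (card-⊥ m)
card-⁅⁆ (suc k) = card-⁅⁆ k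

card≤ : ∀ {m} (V : Subset m) → card V ℕ.≤ m
card≤ [] = z≤n
card≤ (true ∷ V) = s≤s (card≤ V)
card≤ (false ∷ V) = ℕ.m≤n⇒m≤1+n (card≤ V)

card-insert : ∀ {m} (V : Subset m) i → lookup V i ≡ false → card (V [ i ]≔ true) ≡ suc (card V)
card-insert (false ∷ V) zero _ = P.refl
card-insert (true ∷ V) (suc i) i∉V = P.cong suc (card-insert V i i∉V)
card-insert (false ∷ V) (suc i) i∉V = card-insert V i i∉V

card-remove : ∀ {m} (V : Subset m) i → lookup V i ≡ true → suc (card (V [ i ]≔ false)) ≡ card V
card-remove (true ∷ V) zero _ = P.refl
card-remove (true ∷ V) (suc i) i∈V = P.cong suc (card-remove V i i∈V)
card-remove (false ∷ V) (suc i) i∈V = card-remove V i i∈V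

module _ {A : Set} where
  take-[]≔-↑ˡ : ∀ n {k} (W : Vec A (n ℕ.+ k)) (i : Fin n) x → take n (W [ i ↑ˡ k ]≔ x) ≡ take n W [ i ]≔ x
  take-[]≔-↑ˡ (suc n) (w ∷ W) zero x = P.refl
  take-[]≔-↑ˡ (suc n) (w ∷ W) (suc i) x = P.cong (w ∷_) (take-[]≔-↑ˡ n W i x)

  take-[]≔-↑ʳ : ∀ n {k} (W : Vec A (n ℕ.+ k)) (j : Fin k) x → take n (W [ n ↑ʳ j ]≔ x) ≡ take n W
  take-[]≔-↑ʳ zero W j x = P.refl
  take-[]≔-↑ʳ (suc n) (w ∷ W) j x = P.cong (w ∷_) (take-[]≔-↑ʳ n W j x)

  drop-[]≔-↑ˡ : ∀ n {k} (W : Vec A (n ℕ.+ k)) (i : Fin n) x → drop n (W [ i ↑ˡ k ]≔ x) ≡ drop n W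
  drop-[]≔-↑ˡ (suc n) (w ∷ W) zero x = P.refl
  drop-[]≔-↑ˡ (suc n) (w ∷ W) (suc i) x = drop-[]≔-↑ˡ n W i x

  drop-[]≔-↑ʳ : ∀ n {k} (W : Vec A (n ℕ.+ k)) (j : Fin k) x → drop n (W [ n ↑ʳ j ]≔ x) ≡ drop n W [ j ]≔ x
  drop-[]≔-↑ʳ zero W j x = P.refl
  drop-[]≔-↑ʳ (suc n) (w ∷ W) j x = drop-[]≔-↑ʳ n W j x

  lookup-↑ˡ : ∀ n {k} (W : Vec A (n ℕ.+ k)) (i : Fin n) → lookup W (i ↑ˡ k) ≡ lookup (take n W) i
  lookup-↑ˡ (suc n) (w ∷ W) zero = P.refl
  lookup-↑ˡ (suc n) (w ∷ W) (suc i) = lookup-↑ˡ n W i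

  lookup-↑ʳ : ∀ n {k} (W : Vec A (n ℕ.+ k)) (j : Fin k) → lookup W (n ↑ʳ j) ≡ lookup (drop n W) j
  lookup-↑ʳ zero W j = P.refl
  lookup-↑ʳ (suc n) (w ∷ W) j = lookup-↑ʳ n W j

↑ˡ≢↑ʳ : ∀ n {k} (i : Fin n) (j : Fin k) → i ↑ˡ k ≢ n ↑ʳ j
↑ˡ≢↑ʳ (suc n) zero j ()
↑ˡ≢↑ʳ (suc n) (suc i) j eq = ↑ˡ≢↑ʳ n i j (Fin.suc-injective eq)

Increasing : ∀ {m M} → (Fin m → Fin M) → Set
Increasing ι = ∀ a b → a Fin.< b → ι a Fin.< ι b

Increasing-suc : ∀ {m M} {ι : Fin (suc m) → Fin M} → Increasing ι → Increasing (λ k → ι (suc k))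
Increasing-suc inc a b a<b = inc (suc a) (suc b) (s≤s a<b)

image : ∀ {m M} → (Fin m → Fin M) → Subset m → Subset M
image ι [] = ⊥
image ι (true ∷ S) = image (λ k → ι (suc k)) S [ ι zero ]≔ true
image ι (false ∷ S) = image (λ k → ι (suc k)) S

image-above : ∀ {m M} (ι : Fin m → Fin M) b → (∀ k → b ℕ.< toℕ (ι k)) →
  ∀ S p → lookup (image ι S) p ≡ true → b ℕ.< toℕ p
image-above ι b b<ι [] p p∈ with P.trans (P.sym p∈) (lookup-replicate p false)
... | ()
image-above ι b b<ι (true ∷ S) p p∈ with ι zero Fin.≟ p
... | yes P.refl = b<ι zero
... | no ι0≢p = image-above (λ k → ι (suc k)) b (λ k → b<ι (suc k)) S p
                  (P.trans (P.sym (lookup∘update′ (λ eq → ι0≢p (P.sym eq)) (image (λ k → ι (suc k)) S) true)) p∈)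
image-above ι b b<ι (false ∷ S) p p∈ = image-above (λ k → ι (suc k)) b (λ k → b<ι (suc k)) S p p∈

below-≡0 : ∀ {m} (q : Fin m) W → (∀ p → toℕ p ℕ.< toℕ q → lookup W p ≢ true) → below q W ≡ 0
below-≡0 zero W _ = P.refl
below-≡0 (suc q) (true ∷ W) W<q = ⊥-elim (W<q zero (s≤s z≤n) P.refl)
below-≡0 (suc q) (false ∷ W) W<q = below-≡0 q W (λ p p<q → W<q (suc p) (s≤s p<q))

module _ {m M} (ι : Fin (suc m) → Fin M) (inc : Increasing ι) (S : Subset m) where
  private
    tail-image-above : ∀ p → lookup (image (λ k → ι (suc k)) S) p ≡ true → toℕ (ι zero) ℕ.< toℕ p
    tail-image-above = image-above (λ k → ι (suc k)) (toℕ (ι zero)) (λ k → inc zero (suc k) (s≤s z≤n)) S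

  ι₀∉tail-image : lookup (image (λ k → ι (suc k)) S) (ι zero) ≡ false
  ι₀∉tail-image with lookup (image (λ k → ι (suc k)) S) (ι zero) in ι₀∈
  ... | true = ⊥-elim (ℕ.<-irrefl P.refl (tail-image-above (ι zero) ι₀∈))
  ... | false = P.refl

  below-ι₀-tail-image : below (ι zero) (image (λ k → ι (suc k)) S) ≡ 0
  below-ι₀-tail-image = below-≡0 (ι zero) _ (λ p p<ι₀ p∈ → ℕ.<-asym p<ι₀ (tail-image-above p p∈))

image-at : ∀ {m M} (ι : Fin m → Fin M) → Increasing ι → ∀ S k → lookup (image ι S) (ι k) ≡ lookup S k
image-at ι inc (true ∷ S) zero = lookup∘update (ι zero) (image (λ j → ι (suc j)) S) true
image-at ι inc (false ∷ S) zero = ι₀∉tail-image ι inc S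
image-at ι inc (true ∷ S) (suc k) =
  P.trans (lookup∘update′ (λ eq → <⇒≢ (inc zero (suc k) (s≤s z≤n)) (P.sym eq)) (image (λ j → ι (suc j)) S) true)
          (image-at (λ j → ι (suc j)) (Increasing-suc inc) S k)
image-at ι inc (false ∷ S) (suc k) = image-at (λ j → ι (suc j)) (Increasing-suc inc) S k

image-id : ∀ {M} (S : Subset M) → image (λ k → k) S ≡ S
image-id S = lookup-ext (image (λ k → k) S) S (image-at (λ k → k) (λ _ _ k<j → k<j) S)
  where
  lookup-ext : ∀ {A : Set} {m} (U V : Vec A m) → (∀ p → lookup U p ≡ lookup V p) → U ≡ V
  lookup-ext [] [] _ = P.refl
  lookup-ext (u ∷ U) (v ∷ V) eq = P.cong₂ _∷_ (eq zero) (lookup-ext U V (λ p → eq (suc p)))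

module Coefficients {c ℓ} (F : Char0Field c ℓ) where
  open Char0Field F
  open CommutativeRing cring hiding (zero)
  open Exterior F
  open RingProperties ring using (-‿distribʳ-*; -‿involutive; -0#≈0#; -‿+-comm)
  open CommutativeSemigroupProperties +-commutativeSemigroup using () renaming (interchange to +-interchange)
  open import Relation.Binary.Reasoning.Setoid setoid

  signed-cong : ∀ k {x y} → x ≈ y → signed k x ≈ signed k y
  signed-cong zero x≈y = x≈y
  signed-cong (suc k) x≈y = -‿cong (signed-cong k x≈y)

  signed-0# : ∀ k → signed k 0# ≈ 0#
  signed-0# zero = refl
  signed-0# (suc k) = trans (-‿cong (signed-0# k)) -0#≈0#

  signed-+ : ∀ k x y → signed k (x + y) ≈ signed k x + signed k y
  signed-+ zero x y = refl
  signed-+ (suc k) x y = trans (-‿cong (signed-+ k x y)) (sym (-‿+-comm _ _))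

  signed-* : ∀ k a x → signed k (a * x) ≈ a * signed k x
  signed-* zero a x = refl
  signed-* (suc k) a x = trans (-‿cong (signed-* k a x)) (-‿distribʳ-* a _)

  signed-‿ : ∀ k x → signed k (- x) ≈ - signed k x
  signed-‿ zero x = refl
  signed-‿ (suc k) x = -‿cong (signed-‿ k x)

  signed-involutive : ∀ k x → signed k (signed k x) ≈ x
  signed-involutive zero x = refl
  signed-involutive (suc k) x = begin
    - signed k (- signed k x) ≈⟨ -‿cong (signed-‿ k _) ⟩
    - - signed k (signed k x) ≈⟨ -‿involutive _ ⟩
    signed k (signed k x)     ≈⟨ signed-involutive k x ⟩
    x                         ∎

  signed-comm : ∀ a b x → signed a (signed b x) ≈ signed b (signed a x)
  signed-comm zero b x = refl
  signed-comm (suc a) b x = trans (-‿cong (signed-comm a b x)) (sym (signed-‿ b _))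

  ≈0⇒≈-‿ : ∀ {x y} → x ≈ 0# → y ≈ 0# → x ≈ - y
  ≈0⇒≈-‿ x≈0 y≈0 = trans x≈0 (trans (sym -0#≈0#) (-‿cong (sym y≈0)))

  sumSub-cong : ∀ {m} {φ ψ : Subset m → Carrier} → (∀ S → φ S ≈ ψ S) → sumSub φ ≈ sumSub ψ
  sumSub-cong {zero} φ≈ψ = φ≈ψ []
  sumSub-cong {suc m} φ≈ψ = +-cong (sumSub-cong (λ S → φ≈ψ (false ∷ S))) (sumSub-cong (λ S → φ≈ψ (true ∷ S)))

  sumSub-0# : ∀ {m} {φ : Subset m → Carrier} → (∀ S → φ S ≈ 0#) → sumSub φ ≈ 0#
  sumSub-0# {zero} φ≈0 = φ≈0 []
  sumSub-0# {suc m} φ≈0 =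
    trans (+-cong (sumSub-0# (λ S → φ≈0 (false ∷ S))) (sumSub-0# (λ S → φ≈0 (true ∷ S)))) (+-identityʳ 0#)

  sumSub-+ : ∀ {m} (φ ψ : Subset m → Carrier) → sumSub (λ S → φ S + ψ S) ≈ sumSub φ + sumSub ψ
  sumSub-+ {zero} φ ψ = refl
  sumSub-+ {suc m} φ ψ =
    trans (+-cong (sumSub-+ (λ S → φ (false ∷ S)) (λ S → ψ (false ∷ S)))
                  (sumSub-+ (λ S → φ (true ∷ S)) (λ S → ψ (true ∷ S))))
          (+-interchange _ _ _ _)

  sumSub-‿ : ∀ {m} (φ : Subset m → Carrier) → sumSub (λ S → - φ S) ≈ - sumSub φ
  sumSub-‿ {zero} φ = refl
  sumSub-‿ {suc m} φ = trans (+-cong (sumSub-‿ (λ S → φ (false ∷ S))) (sumSub-‿ (λ S → φ (true ∷ S)))) (-‿+-comm _ _)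

  sumSub-δ : ∀ {m} (φ : Subset m → Carrier) U → (∀ S → S ≢ U → φ S ≈ 0#) → sumSub φ ≈ φ U
  sumSub-δ {zero} φ [] _ = refl
  sumSub-δ {suc m} φ (false ∷ U) φ≈0 = trans
    (+-cong (sumSub-δ _ U (λ S S≢U → φ≈0 (false ∷ S) (λ eq → S≢U (∷-injectiveʳ eq))))
            (sumSub-0# (λ S → φ≈0 (true ∷ S) (λ ()))))
    (+-identityʳ _)
  sumSub-δ {suc m} φ (true ∷ U) φ≈0 = trans
    (+-cong (sumSub-0# (λ S → φ≈0 (false ∷ S) (λ ())))
            (sumSub-δ _ U (λ S S≢U → φ≈0 (true ∷ S) (λ eq → S≢U (∷-injectiveʳ eq)))))
    (+-identityˡ _)

  e-diag : ∀ {m} (U : Subset m) → e U U ≈ 1#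
  e-diag U rewrite dec-true (≡-dec Bool._≟_ U U) P.refl = refl

  e-offdiag : ∀ {m} (U W : Subset m) → U ≢ W → e U W ≈ 0#
  e-offdiag U W U≢W with ≡-dec Bool._≟_ U W
  ... | yes U≡W = ⊥-elim (U≢W U≡W)
  ... | no _ = refl

  mulGen : ∀ {m} → Fin m → Ext m → Ext m
  mulGen p h W = if lookup W p then signed (below p W) (h (W [ p ]≔ false)) else 0#

  module _ {m} (p : Fin m) where
    mulGen-∈ : ∀ h W → lookup W p ≡ true → mulGen p h W ≈ signed (below p W) (h (W [ p ]≔ false))
    mulGen-∈ h W p∈W rewrite p∈W = refl

    mulGen-∉ : ∀ h W → lookup W p ≡ false → mulGen p h W ≈ 0#
    mulGen-∉ h W p∉W rewrite p∉W = refl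

    ∂-∈ : ∀ h W → lookup W p ≡ true → ∂ p h W ≈ 0#
    ∂-∈ h W p∈W rewrite p∈W = refl

    ∂-∉ : ∀ h W → lookup W p ≡ false → ∂ p h W ≈ signed (below p W) (h (W [ p ]≔ true))
    ∂-∉ h W p∉W rewrite p∉W = refl

    mulGen-cong : ∀ {h h′} → h ≈E h′ → mulGen p h ≈E mulGen p h′
    mulGen-cong h≈h′ W with lookup W p
    ... | true = signed-cong (below p W) (h≈h′ _)
    ... | false = refl

    ∂-cong : ∀ {h h′} → h ≈E h′ → ∂ p h ≈E ∂ p h′
    ∂-cong h≈h′ W with lookup W p
    ... | true = refl
    ... | false = signed-cong (below p W) (h≈h′ _)

    mulGen-+ : ∀ h h′ → mulGen p (h +E h′) ≈E (mulGen p h +E mulGen p h′)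
    mulGen-+ h h′ W with lookup W p
    ... | true = signed-+ (below p W) _ _
    ... | false = sym (+-identityʳ 0#)

    ∂-+ : ∀ h h′ → ∂ p (h +E h′) ≈E (∂ p h +E ∂ p h′)
    ∂-+ h h′ W with lookup W p
    ... | true = sym (+-identityʳ 0#)
    ... | false = signed-+ (below p W) _ _

    mulGen-* : ∀ a h → mulGen p (a ·E h) ≈E (a ·E mulGen p h)
    mulGen-* a h W with lookup W p
    ... | true = signed-* (below p W) a _
    ... | false = sym (zeroʳ a)

    ∂-* : ∀ a h → ∂ p (a ·E h) ≈E (a ·E ∂ p h)
    ∂-* a h W with lookup W p
    ... | true = sym (zeroʳ a)
    ... | false = signed-* (below p W) a _

    mulGen-0E : mulGen p 0E ≈E 0E
    mulGen-0E W with lookup W p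
    ... | true = signed-0# (below p W)
    ... | false = refl

    ∂-0E : ∂ p 0E ≈E 0E
    ∂-0E W with lookup W p
    ... | true = refl
    ... | false = signed-0# (below p W)

    mulGen-‿ : ∀ h → mulGen p (λ V → - h V) ≈E (λ W → - mulGen p h W)
    mulGen-‿ h W with lookup W p
    ... | true = signed-‿ (below p W) _
    ... | false = sym -0#≈0#

  mulGen-mulGen-self : ∀ {m} (p : Fin m) h → mulGen p (mulGen p h) ≈E 0E
  mulGen-mulGen-self p h W with lookup W p
  ... | true = trans (signed-cong (below p W) (mulGen-∉ p h _ (lookup∘update p W false))) (signed-0# (below p W))
  ... | false = refl

  mulGen-anticomm-< : ∀ {m} {p q : Fin m} h W → p Fin.< q → mulGen p (mulGen q h) W ≈ - mulGen q (mulGen p h) W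
  mulGen-anticomm-< {p = p} {q} h W p<q with lookup W p in p∈ | lookup W q in q∈
  ... | false | false = ≈0⇒≈-‿ refl refl
  ... | false | true = ≈0⇒≈-‿ refl
    (trans (signed-cong (below q W) (mulGen-∉ p h _ (P.trans (lookup∘update′ p≢q W false) p∈))) (signed-0# (below q W)))
    where p≢q = <⇒≢ p<q
  ... | true | false = ≈0⇒≈-‿
    (trans (signed-cong (below p W) (mulGen-∉ q h _ (P.trans (lookup∘update′ q≢p W false) q∈))) (signed-0# (below p W))) refl
    where q≢p = λ q≡p → <⇒≢ p<q (P.sym q≡p)
  ... | true | true = begin
    signed (below p W) (mulGen q h (W [ p ]≔ false))
      ≈⟨ signed-cong (below p W) (mulGen-∈ q h _ (P.trans (lookup∘update′ q≢p W false) q∈)) ⟩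
    signed (below p W) (signed b (h ((W [ p ]≔ false) [ q ]≔ false)))
      ≈⟨ signed-comm (below p W) b _ ⟩
    signed b (signed (below p W) (h ((W [ p ]≔ false) [ q ]≔ false)))
      ≈⟨ reflexive (P.cong₂ (λ k V → signed b (signed k (h V)))
           (P.sym (below-[]≔-≥ W q p false (ℕ.<⇒≤ p<q))) ([]≔-commutes W p q (<⇒≢ p<q))) ⟩
    signed b (signed (below p (W [ q ]≔ false)) (h ((W [ q ]≔ false) [ p ]≔ false)))
      ≈⟨ sym (-‿involutive _) ⟩
    - signed (suc b) (signed (below p (W [ q ]≔ false)) (h ((W [ q ]≔ false) [ p ]≔ false)))
      ≈⟨ reflexive (P.cong (λ k → - signed k (signed (below p (W [ q ]≔ false)) (h ((W [ q ]≔ false) [ p ]≔ false))))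
           (P.sym (below-remove W p q p<q p∈))) ⟩
    - signed (below q W) (signed (below p (W [ q ]≔ false)) (h ((W [ q ]≔ false) [ p ]≔ false)))
      ≈⟨ -‿cong (signed-cong (below q W) (sym (mulGen-∈ p h _ (P.trans (lookup∘update′ p≢q W false) p∈)))) ⟩
    - signed (below q W) (mulGen p h (W [ q ]≔ false)) ∎
    where
    p≢q = <⇒≢ p<q
    q≢p = λ q≡p → p≢q (P.sym q≡p)
    b = below q (W [ p ]≔ false)

  mulGen-anticomm : ∀ {m} (p q : Fin m) h W → mulGen p (mulGen q h) W ≈ - mulGen q (mulGen p h) W
  mulGen-anticomm p q h W with <-cmp p q
  ... | tri< p<q _ _ = mulGen-anticomm-< h W p<q
  ... | tri≈ _ P.refl _ = ≈0⇒≈-‿ (mulGen-mulGen-self p h W) (mulGen-mulGen-self p h W)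
  ... | tri> _ _ q<p = trans (sym (-‿involutive _)) (-‿cong (sym (mulGen-anticomm-< h W q<p)))

  ∂-mulGen-sign : ∀ {m} (W : Subset m) p q → p ≢ q → lookup W p ≡ false → lookup W q ≡ true → ∀ X →
    signed (below p W) (signed (below q (W [ p ]≔ true)) X) ≈ - signed (below q W) (signed (below p (W [ q ]≔ false)) X)
  ∂-mulGen-sign W p q p≢q p∉W q∈W X with <-cmp p q
  ... | tri≈ _ p≡q _ = ⊥-elim (p≢q p≡q)
  ... | tri< p<q _ _ = begin
    signed (below p W) (signed (below q (W [ p ]≔ true)) X)
      ≈⟨ reflexive (P.cong (λ k → signed (below p W) (signed k X))
           (P.trans (below-[]≔-< W p q p<q) (P.cong (λ V → suc (below q V)) ([]≔-self W p p∉W)))) ⟩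
    signed (below p W) (- signed (below q W) X) ≈⟨ signed-‿ (below p W) _ ⟩
    - signed (below p W) (signed (below q W) X) ≈⟨ -‿cong (signed-comm (below p W) (below q W) X) ⟩
    - signed (below q W) (signed (below p W) X)
      ≈⟨ reflexive (P.cong (λ k → - signed (below q W) (signed k X)) (P.sym (below-[]≔-≥ W q p false (ℕ.<⇒≤ p<q)))) ⟩
    - signed (below q W) (signed (below p (W [ q ]≔ false)) X) ∎
  ... | tri> _ _ q<p = begin
    signed (below p W) (signed (below q (W [ p ]≔ true)) X)
      ≈⟨ reflexive (P.cong₂ (λ k k′ → signed k (signed k′ X))
           (below-remove W q p q<p q∈W) (below-[]≔-≥ W p q true (ℕ.<⇒≤ q<p))) ⟩
    - signed (below p (W [ q ]≔ false)) (signed (below q W) X)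
      ≈⟨ -‿cong (signed-comm (below p (W [ q ]≔ false)) (below q W) X) ⟩
    - signed (below q W) (signed (below p (W [ q ]≔ false)) X) ∎

  ∂-mulGen-anticomm : ∀ {m} (p q : Fin m) h W → p ≢ q → ∂ p (mulGen q h) W ≈ - mulGen q (∂ p h) W
  ∂-mulGen-anticomm p q h W p≢q with lookup W p in p∈ | lookup W q in q∈
  ... | true | false = ≈0⇒≈-‿ refl refl
  ... | true | true = ≈0⇒≈-‿ refl
    (trans (signed-cong (below q W) (∂-∈ p h _ (P.trans (lookup∘update′ p≢q W false) p∈))) (signed-0# (below q W)))
  ... | false | false = ≈0⇒≈-‿
    (trans (signed-cong (below p W) (mulGen-∉ q h _ (P.trans (lookup∘update′ q≢p W true) q∈))) (signed-0# (below p W))) refl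
    where q≢p = λ q≡p → p≢q (P.sym q≡p)
  ... | false | true = begin
    signed (below p W) (mulGen q h (W [ p ]≔ true))
      ≈⟨ signed-cong (below p W) (mulGen-∈ q h _ (P.trans (lookup∘update′ q≢p W true) q∈)) ⟩
    signed (below p W) (signed (below q (W [ p ]≔ true)) (h ((W [ p ]≔ true) [ q ]≔ false)))
      ≈⟨ reflexive (P.cong (λ V → signed (below p W) (signed (below q (W [ p ]≔ true)) (h V))) ([]≔-commutes W p q p≢q)) ⟩
    signed (below p W) (signed (below q (W [ p ]≔ true)) (h ((W [ q ]≔ false) [ p ]≔ true)))
      ≈⟨ ∂-mulGen-sign W p q p≢q p∈ q∈ _ ⟩
    - signed (below q W) (signed (below p (W [ q ]≔ false)) (h ((W [ q ]≔ false) [ p ]≔ true)))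
      ≈⟨ -‿cong (signed-cong (below q W) (sym (∂-∉ p h _ (P.trans (lookup∘update′ p≢q W false) p∈)))) ⟩
    - signed (below q W) (∂ p h (W [ q ]≔ false)) ∎
    where q≢p = λ q≡p → p≢q (P.sym q≡p)

  ∂-mulGen-self : ∀ {m} (p : Fin m) h W → ∂ p (mulGen p h) W + mulGen p (∂ p h) W ≈ h W
  ∂-mulGen-self p h W with lookup W p in p∈
  ... | true = begin
    0# + signed (below p W) (∂ p h (W [ p ]≔ false)) ≈⟨ +-identityˡ _ ⟩
    signed (below p W) (∂ p h (W [ p ]≔ false))
      ≈⟨ signed-cong (below p W) (∂-∉ p h _ (lookup∘update p W false)) ⟩
    signed (below p W) (signed (below p (W [ p ]≔ false)) (h ((W [ p ]≔ false) [ p ]≔ true)))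
      ≈⟨ reflexive (P.cong₂ (λ k V → signed (below p W) (signed k (h V)))
           (below-[]≔-≥ W p p false ℕ.≤-refl) (P.trans ([]≔-idempotent W p) ([]≔-self W p p∈))) ⟩
    signed (below p W) (signed (below p W) (h W)) ≈⟨ signed-involutive (below p W) (h W) ⟩
    h W ∎
  ... | false = begin
    signed (below p W) (mulGen p h (W [ p ]≔ true)) + 0# ≈⟨ +-identityʳ _ ⟩
    signed (below p W) (mulGen p h (W [ p ]≔ true))
      ≈⟨ signed-cong (below p W) (mulGen-∈ p h _ (lookup∘update p W true)) ⟩
    signed (below p W) (signed (below p (W [ p ]≔ true)) (h ((W [ p ]≔ true) [ p ]≔ false)))
      ≈⟨ reflexive (P.cong₂ (λ k V → signed (below p W) (signed k (h V)))
           (below-[]≔-≥ W p p true ℕ.≤-refl) (P.trans ([]≔-idempotent W p) ([]≔-self W p p∈))) ⟩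
    signed (below p W) (signed (below p W) (h W)) ≈⟨ signed-involutive (below p W) (h W) ⟩
    h W ∎

  ∧-congʳ : ∀ {m} (x : Ext m) {h h′} → h ≈E h′ → (x ∧ h) ≈E (x ∧ h′)
  ∧-congʳ {m} x h≈h′ W = sumSub-cong {m} (λ S → sumSub-cong {m} (λ U → *-congʳ (*-congˡ (h≈h′ U))))

  ∧-distribʳ : ∀ {m} (x y h : Ext m) → ((x +E y) ∧ h) ≈E ((x ∧ h) +E (y ∧ h))
  ∧-distribʳ {m} x y h W = begin
    sumSub (λ S → sumSub (λ U → ((x S + y S) * h U) * mulCoef S U W))
      ≈⟨ sumSub-cong {m} (λ S → sumSub-cong {m} (λ U → trans (*-congʳ (distribʳ (h U) (x S) (y S))) (distribʳ _ _ _))) ⟩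
    sumSub (λ S → sumSub (λ U → (x S * h U) * mulCoef S U W + (y S * h U) * mulCoef S U W))
      ≈⟨ sumSub-cong {m} (λ S → sumSub-+ {m} (λ U → (x S * h U) * mulCoef S U W) (λ U → (y S * h U) * mulCoef S U W)) ⟩
    sumSub (λ S → sumSub (λ U → (x S * h U) * mulCoef S U W) + sumSub (λ U → (y S * h U) * mulCoef S U W))
      ≈⟨ sumSub-+ {m} _ _ ⟩
    (x ∧ h) W + (y ∧ h) W ∎

  private
    sumSub-*0# : ∀ {m} (φ : Subset m → Carrier) → sumSub (λ U → φ U * 0#) ≈ 0#
    sumSub-*0# φ = sumSub-0# (λ U → zeroʳ (φ U))

  mulCoef-⊥ : ∀ {m} h (W : Subset m) → sumSub (λ U → h U * mulCoef ⊥ U W) ≈ h W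
  mulCoef-⊥ {zero} h [] = *-identityʳ _
  mulCoef-⊥ {suc m} h (false ∷ W) =
    trans (+-cong (mulCoef-⊥ (λ U → h (false ∷ U)) W) (sumSub-*0# {m} _)) (+-identityʳ _)
  mulCoef-⊥ {suc m} h (true ∷ W) = begin
    sumSub (λ U → h (false ∷ U) * 0#) + sumSub (λ U → h (true ∷ U) * signed (card (⊥ {m})) (mulCoef ⊥ U W))
      ≈⟨ +-cong (sumSub-*0# {m} _)
                (sumSub-cong {m} (λ U → *-congˡ (reflexive (P.cong (λ k → signed k (mulCoef ⊥ U W)) (card-⊥ m))))) ⟩
    0# + sumSub (λ U → h (true ∷ U) * mulCoef ⊥ U W) ≈⟨ +-identityˡ _ ⟩
    sumSub (λ U → h (true ∷ U) * mulCoef ⊥ U W)     ≈⟨ mulCoef-⊥ (λ U → h (true ∷ U)) W ⟩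
    h (true ∷ W) ∎

  mulCoef-⁅⁆ : ∀ {m} (k : Fin m) h W → sumSub (λ U → h U * mulCoef ⁅ k ⁆ U W) ≈ mulGen k h W
  mulCoef-⁅⁆ {suc m} zero h (true ∷ W) = trans (+-cong (mulCoef-⊥ (λ U → h (false ∷ U)) W) (sumSub-*0# {m} _)) (+-identityʳ _)
  mulCoef-⁅⁆ {suc m} zero h (false ∷ W) = trans (+-cong (sumSub-*0# {m} _) (sumSub-*0# {m} _)) (+-identityʳ _)
  mulCoef-⁅⁆ {suc m} (suc k) h (false ∷ W) =
    trans (+-cong (mulCoef-⁅⁆ k (λ U → h (false ∷ U)) W) (sumSub-*0# {m} _)) (+-identityʳ _)
  mulCoef-⁅⁆ {suc m} (suc k) h (true ∷ W) = begin
    sumSub (λ U → h (false ∷ U) * 0#) + sumSub (λ U → h (true ∷ U) * signed (card ⁅ k ⁆) (mulCoef ⁅ k ⁆ U W))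
      ≈⟨ +-cong (sumSub-*0# {m} _) (sumSub-cong {m} (λ U → trans
           (*-congˡ (reflexive (P.cong (λ j → signed j (mulCoef ⁅ k ⁆ U W)) (card-⁅⁆ k)))) (sym (-‿distribʳ-* _ _)))) ⟩
    0# + sumSub (λ U → - (h (true ∷ U) * mulCoef ⁅ k ⁆ U W)) ≈⟨ +-identityˡ _ ⟩
    sumSub (λ U → - (h (true ∷ U) * mulCoef ⁅ k ⁆ U W))     ≈⟨ sumSub-‿ {m} _ ⟩
    - sumSub (λ U → h (true ∷ U) * mulCoef ⁅ k ⁆ U W)       ≈⟨ -‿cong (mulCoef-⁅⁆ k (λ U → h (true ∷ U)) W) ⟩
    - mulGen k (λ U → h (true ∷ U)) W                       ≈⟨ tail-sign ⟩
    mulGen (suc k) h (true ∷ W) ∎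
    where
    tail-sign : - mulGen k (λ U → h (true ∷ U)) W ≈ mulGen (suc k) h (true ∷ W)
    tail-sign with lookup W k
    ... | true = refl
    ... | false = -0#≈0#

  gen-∧ : ∀ {m} (k : Fin m) h → (gen k ∧ h) ≈E mulGen k h
  gen-∧ {m} k h W = begin
    sumSub (λ S → sumSub (λ U → (e ⁅ k ⁆ S * h U) * mulCoef S U W))
      ≈⟨ sumSub-δ _ ⁅ k ⁆ (λ S S≢k → sumSub-0# {m} (λ U →
           trans (*-congʳ (trans (*-congʳ (e-offdiag ⁅ k ⁆ S (λ eq → S≢k (P.sym eq)))) (zeroˡ _))) (zeroˡ _))) ⟩
    sumSub (λ U → (e ⁅ k ⁆ ⁅ k ⁆ * h U) * mulCoef ⁅ k ⁆ U W)
      ≈⟨ sumSub-cong {m} (λ U → *-congʳ (trans (*-congʳ (e-diag ⁅ k ⁆)) (*-identityˡ _))) ⟩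
    sumSub (λ U → h U * mulCoef ⁅ k ⁆ U W) ≈⟨ mulCoef-⁅⁆ k h W ⟩
    mulGen k h W ∎

  mulGen-e : ∀ {m} (k : Fin m) U → lookup U k ≡ false → below k U ≡ 0 → mulGen k (e U) ≈E e (U [ k ]≔ true)
  mulGen-e k U k∉U below≡0 W with lookup W k in k∈W
  ... | false = sym (e-offdiag (U [ k ]≔ true) W (λ eq → true≢false
          (P.trans (P.sym (lookup∘update k U true)) (P.trans (P.cong (λ V → lookup V k) eq) k∈W))))
    where
    true≢false : true ≢ false
    true≢false ()
  ... | true with ≡-dec Bool._≟_ U (W [ k ]≔ false)
  ...   | no U≢W-k = trans (signed-0# (below k W)) (sym (e-offdiag (U [ k ]≔ true) W (λ eq → U≢W-k
          (P.trans (P.sym ([]≔-self U k k∉U)) (P.trans (P.sym ([]≔-idempotent U k)) (P.cong (_[ k ]≔ false) eq))))))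
  ...   | yes P.refl = begin
    signed (below k W) 1#
      ≈⟨ reflexive (P.cong (λ j → signed j 1#) (P.trans (P.sym (below-[]≔-≥ W k k false ℕ.≤-refl)) below≡0)) ⟩
    1# ≈⟨ sym (e-diag W) ⟩
    e W W ≈⟨ reflexive (P.cong (λ V → e V W) (P.sym (P.trans ([]≔-idempotent W k) ([]≔-self W k k∈W)))) ⟩
    e ((W [ k ]≔ false) [ k ]≔ true) W ∎

  prodOver-gen-image : ∀ {m M} (ι : Fin m → Fin M) → Increasing ι → ∀ S → prodOver (λ k → gen (ι k)) S ≈E e (image ι S)
  prodOver-gen-image ι inc [] W = refl
  prodOver-gen-image ι inc (false ∷ S) = prodOver-gen-image (λ k → ι (suc k)) (Increasing-suc inc) S
  prodOver-gen-image ι inc (true ∷ S) W = begin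
    (gen (ι zero) ∧ prodOver (λ k → gen (ι (suc k))) S) W ≈⟨ gen-∧ (ι zero) _ W ⟩
    mulGen (ι zero) (prodOver (λ k → gen (ι (suc k))) S) W
      ≈⟨ mulGen-cong (ι zero) (prodOver-gen-image (λ k → ι (suc k)) (Increasing-suc inc) S) W ⟩
    mulGen (ι zero) (e (image (λ k → ι (suc k)) S)) W
      ≈⟨ mulGen-e (ι zero) _ (ι₀∉tail-image ι inc S) (below-ι₀-tail-image ι inc S) W ⟩
    e (image ι (true ∷ S)) W ∎

  prodOver-gen : ∀ {M} (S : Subset M) → prodOver gen S ≈E e S
  prodOver-gen S W = trans (prodOver-gen-image (λ k → k) (λ _ _ k<j → k<j) S W) (reflexive (P.cong (λ V → e V W) (image-id S)))

  module _ {M : ℕ} where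
    sumFin-cong-at : ∀ {k} {g g′ : Fin k → Ext M} W → (∀ i → g i W ≈ g′ i W) → sumFin g W ≈ sumFin g′ W
    sumFin-cong-at {zero} W _ = refl
    sumFin-cong-at {suc k} W g≈g′ = +-cong (g≈g′ zero) (sumFin-cong-at W (λ i → g≈g′ (suc i)))

    sumFin-cong : ∀ {k} {g g′ : Fin k → Ext M} → (∀ i → g i ≈E g′ i) → sumFin g ≈E sumFin g′
    sumFin-cong g≈g′ W = sumFin-cong-at W (λ i → g≈g′ i W)

    sumFin-+ : ∀ {k} (g g′ : Fin k → Ext M) → sumFin (λ i → g i +E g′ i) ≈E (sumFin g +E sumFin g′)
    sumFin-+ {zero} g g′ W = sym (+-identityʳ 0#)
    sumFin-+ {suc k} g g′ W = trans (+-congˡ (sumFin-+ (λ i → g (suc i)) (λ i → g′ (suc i)) W)) (+-interchange _ _ _ _)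

    sumFin-* : ∀ {k} a (g : Fin k → Ext M) → sumFin (λ i → a ·E g i) ≈E (a ·E sumFin g)
    sumFin-* {zero} a g W = sym (zeroʳ a)
    sumFin-* {suc k} a g W = trans (+-congˡ (sumFin-* a (λ i → g (suc i)) W)) (sym (distribˡ a _ _))

    sumFin-0E : ∀ {k} (g : Fin k → Ext M) → (∀ i → g i ≈E 0E) → sumFin g ≈E 0E
    sumFin-0E {zero} g g≈0 W = refl
    sumFin-0E {suc k} g g≈0 W =
      trans (+-cong (g≈0 zero W) (sumFin-0E (λ i → g (suc i)) (λ i → g≈0 (suc i)) W)) (+-identityʳ 0#)

    sumFin-extract : ∀ {k} (g g′ : Fin k → Ext M) y b → (∀ i → i ≢ b → g i ≈E g′ i) → g b ≈E (g′ b +E y) →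
      sumFin g ≈E (sumFin g′ +E y)
    sumFin-extract {suc k} g g′ y zero g≈g′ gb W = begin
      g zero W + sumFin (λ i → g (suc i)) W
        ≈⟨ +-cong (gb W) (sumFin-cong (λ i → g≈g′ (suc i) (λ ())) W) ⟩
      (g′ zero W + y W) + sumFin (λ i → g′ (suc i)) W ≈⟨ +-assoc _ _ _ ⟩
      g′ zero W + (y W + sumFin (λ i → g′ (suc i)) W) ≈⟨ +-congˡ (+-comm _ _) ⟩
      g′ zero W + (sumFin (λ i → g′ (suc i)) W + y W) ≈⟨ sym (+-assoc _ _ _) ⟩
      (g′ zero W + sumFin (λ i → g′ (suc i)) W) + y W ∎
    sumFin-extract {suc k} g g′ y (suc b) g≈g′ gb W = begin
      g zero W + sumFin (λ i → g (suc i)) W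
        ≈⟨ +-cong (g≈g′ zero (λ ()) W)
                  (sumFin-extract (λ i → g (suc i)) (λ i → g′ (suc i)) y b
                    (λ i i≢b → g≈g′ (suc i) (λ eq → i≢b (Fin.suc-injective eq))) gb W) ⟩
      g′ zero W + (sumFin (λ i → g′ (suc i)) W + y W) ≈⟨ sym (+-assoc _ _ _) ⟩
      (g′ zero W + sumFin (λ i → g′ (suc i)) W) + y W ∎

    mulGen-sumFin : ∀ {k} (p : Fin M) (g : Fin k → Ext M) → mulGen p (sumFin g) ≈E sumFin (λ i → mulGen p (g i))
    mulGen-sumFin {zero} p g = mulGen-0E p
    mulGen-sumFin {suc k} p g W =
      trans (mulGen-+ p (g zero) (sumFin (λ i → g (suc i))) W) (+-congˡ (mulGen-sumFin p (λ i → g (suc i)) W))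

module Tau {c ℓ} (F : Char0Field c ℓ) (n : ℕ) where
  open Char0Field F
  open CommutativeRing cring hiding (zero)
  open Exterior F
  open En n
  open Coefficients F
  open RingProperties ring using (-‿involutive)
  open import Relation.Binary.Reasoning.Setoid setoid

  αpos θpos : Fin n → Fin (n ℕ.+ n)
  αpos i = i ↑ˡ n
  θpos i = n ↑ʳ i

  τ′ : E → E
  τ′ f = sumFin (λ i → mulGen (αpos i) (∂ (θpos i) f))

  τ≈τ′ : ∀ f → τ f ≈E τ′ f
  τ≈τ′ f = sumFin-cong (λ i → gen-∧ (αpos i) (∂ (θpos i) f))

  τ′-cong : ∀ {f f′} → f ≈E f′ → τ′ f ≈E τ′ f′
  τ′-cong f≈f′ = sumFin-cong (λ i → mulGen-cong (αpos i) (∂-cong (θpos i) f≈f′))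

  τ′-+ : ∀ f g → τ′ (f +E g) ≈E (τ′ f +E τ′ g)
  τ′-+ f g W = trans
    (sumFin-cong (λ i V → trans (mulGen-cong (αpos i) (∂-+ (θpos i) f g) V)
                                (mulGen-+ (αpos i) (∂ (θpos i) f) (∂ (θpos i) g) V)) W)
    (sumFin-+ (λ i → mulGen (αpos i) (∂ (θpos i) f)) (λ i → mulGen (αpos i) (∂ (θpos i) g)) W)

  τ′-* : ∀ a f → τ′ (a ·E f) ≈E (a ·E τ′ f)
  τ′-* a f W = trans
    (sumFin-cong (λ i V → trans (mulGen-cong (αpos i) (∂-* (θpos i) a f) V) (mulGen-* (αpos i) a (∂ (θpos i) f) V)) W)
    (sumFin-* a (λ i → mulGen (αpos i) (∂ (θpos i) f)) W)

  τ′-0E : τ′ 0E ≈E 0E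
  τ′-0E = sumFin-0E (λ i → mulGen (αpos i) (∂ (θpos i) 0E))
    (λ i V → trans (mulGen-cong (αpos i) (∂-0E (θpos i)) V) (mulGen-0E (αpos i) V))

  private
    θ-summand-mulGen : ∀ i q h → θpos i ≢ q →
      mulGen (αpos i) (∂ (θpos i) (mulGen q h)) ≈E mulGen q (mulGen (αpos i) (∂ (θpos i) h))
    θ-summand-mulGen i q h θi≢q W = begin
      mulGen (αpos i) (∂ (θpos i) (mulGen q h)) W
        ≈⟨ mulGen-cong (αpos i) (λ V → ∂-mulGen-anticomm (θpos i) q h V θi≢q) W ⟩
      mulGen (αpos i) (λ V → - mulGen q (∂ (θpos i) h) V) W ≈⟨ mulGen-‿ (αpos i) (mulGen q (∂ (θpos i) h)) W ⟩
      - mulGen (αpos i) (mulGen q (∂ (θpos i) h)) W        ≈⟨ -‿cong (mulGen-anticomm (αpos i) q (∂ (θpos i) h) W) ⟩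
      - - mulGen q (mulGen (αpos i) (∂ (θpos i) h)) W      ≈⟨ -‿involutive _ ⟩
      mulGen q (mulGen (αpos i) (∂ (θpos i) h)) W          ∎

  τ′-mulGen-α : ∀ a h → τ′ (mulGen (αpos a) h) ≈E mulGen (αpos a) (τ′ h)
  τ′-mulGen-α a h W = trans
    (sumFin-cong (λ i → θ-summand-mulGen i (αpos a) h (λ eq → ↑ˡ≢↑ʳ n a i (P.sym eq))) W)
    (sym (mulGen-sumFin (αpos a) (λ i → mulGen (αpos i) (∂ (θpos i) h)) W))

  τ′-mulGen-θ : ∀ b h → τ′ (mulGen (θpos b) h) ≈E (mulGen (θpos b) (τ′ h) +E mulGen (αpos b) h)
  τ′-mulGen-θ b h W = trans
    (sumFin-extract summand commuted (mulGen (αpos b) h) b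
      (λ i i≢b → θ-summand-mulGen i (θpos b) h (λ eq → i≢b (↑ʳ-injective n i b eq))) summand-b W)
    (+-congʳ (sym (mulGen-sumFin (θpos b) (λ i → mulGen (αpos i) (∂ (θpos i) h)) W)))
    where
    summand commuted : Fin n → E
    summand i = mulGen (αpos i) (∂ (θpos i) (mulGen (θpos b) h))
    commuted i = mulGen (θpos b) (mulGen (αpos i) (∂ (θpos i) h))
    ∂θ-mulGenθ : ∀ V → ∂ (θpos b) (mulGen (θpos b) h) V ≈ h V - mulGen (θpos b) (∂ (θpos b) h) V
    ∂θ-mulGenθ V = begin
      ∂ (θpos b) (mulGen (θpos b) h) V
        ≈⟨ sym (xyx⁻¹≈y (mulGen (θpos b) (∂ (θpos b) h) V) _) ⟩
      mulGen (θpos b) (∂ (θpos b) h) V + ∂ (θpos b) (mulGen (θpos b) h) V - mulGen (θpos b) (∂ (θpos b) h) V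
        ≈⟨ +-congʳ (trans (+-comm _ _) (∂-mulGen-self (θpos b) h V)) ⟩
      h V - mulGen (θpos b) (∂ (θpos b) h) V ∎
      where open AbelianGroupProperties +-abelianGroup using (xyx⁻¹≈y)
    summand-b : summand b ≈E (commuted b +E mulGen (αpos b) h)
    summand-b W = begin
      mulGen (αpos b) (∂ (θpos b) (mulGen (θpos b) h)) W
        ≈⟨ mulGen-cong (αpos b) ∂θ-mulGenθ W ⟩
      mulGen (αpos b) (h +E (λ V → - mulGen (θpos b) (∂ (θpos b) h) V)) W
        ≈⟨ mulGen-+ (αpos b) h (λ V → - mulGen (θpos b) (∂ (θpos b) h) V) W ⟩
      mulGen (αpos b) h W + mulGen (αpos b) (λ V → - mulGen (θpos b) (∂ (θpos b) h) V) W
        ≈⟨ +-congˡ (trans (mulGen-‿ (αpos b) (mulGen (θpos b) (∂ (θpos b) h)) W)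
                          (-‿cong (mulGen-anticomm (αpos b) (θpos b) (∂ (θpos b) h) W))) ⟩
      mulGen (αpos b) h W + - - commuted b W ≈⟨ +-congˡ (-‿involutive _) ⟩
      mulGen (αpos b) h W + commuted b W     ≈⟨ +-comm _ _ ⟩
      commuted b W + mulGen (αpos b) h W     ∎

  αdeg θdeg : Subset (n ℕ.+ n) → ℕ
  αdeg V = card (take n V)
  θdeg V = card (drop n V)

  αdeg≤n : ∀ V → αdeg V ℕ.≤ n
  αdeg≤n V = card≤ (take n V)

  _⇝_ : Subset (n ℕ.+ n) → Subset (n ℕ.+ n) → Set
  V ⇝ W = (suc (αdeg V) ≡ αdeg W) × (θdeg V ≡ suc (θdeg W))

  τ′-local : ∀ f f′ W → (∀ V → V ⇝ W → f V ≈ f′ V) → τ′ f W ≈ τ′ f′ W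
  τ′-local f f′ W f≈f′ = sumFin-cong-at W summand
    where
    summand : ∀ i → mulGen (αpos i) (∂ (θpos i) f) W ≈ mulGen (αpos i) (∂ (θpos i) f′) W
    summand i with lookup W (αpos i) in αi∈W
    ... | false = refl
    ... | true = signed-cong (below (αpos i) W) inner
      where
      U = W [ αpos i ]≔ false
      source : lookup U (θpos i) ≡ false → (U [ θpos i ]≔ true) ⇝ W
      source θi∉U =
        P.trans (P.cong (λ X → suc (card X)) (P.trans (take-[]≔-↑ʳ n U i true) (take-[]≔-↑ˡ n W i false)))
                (card-remove (take n W) i (P.trans (P.sym (lookup-↑ˡ n W i)) αi∈W)) ,
        P.trans (P.cong card (P.trans (drop-[]≔-↑ʳ n U i true) (P.cong (_[ i ]≔ true) (drop-[]≔-↑ˡ n W i false))))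
                (card-insert (drop n W) i (P.trans (P.sym (lookup-↑ʳ n W i))
                  (P.trans (P.sym (lookup∘update′ (λ eq → ↑ˡ≢↑ʳ n i i (P.sym eq)) W false)) θi∉U)))
      inner : ∂ (θpos i) f U ≈ ∂ (θpos i) f′ U
      inner with lookup U (θpos i) in θi∈U
      ... | true = refl
      ... | false = signed-cong (below (θpos i) U) (f≈f′ _ (source θi∈U))

  τ′-local-zero : ∀ f W → (∀ V → V ⇝ W → f V ≈ 0#) → τ′ f W ≈ 0#
  τ′-local-zero f W f≈0 = trans (τ′-local f 0E W f≈0) (τ′-0E W)

  vanish-below-αdeg : (g : ℕ → E) → (∀ j W → (∀ V → V ⇝ W → g j V ≈ 0#) → g (suc j) W ≈ 0#) →
    ∀ j W → αdeg W ℕ.< j → g j W ≈ 0#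
  vanish-below-αdeg g step (suc j) W αW<1+j =
    step j W (λ V V⇝W → vanish-below-αdeg g step j V (ℕ.≤-trans (ℕ.≤-reflexive (proj₁ V⇝W)) (ℕ.≤-pred αW<1+j)))

-- Divided powers of τ and its exponential

module Exponential {c ℓ} (F : Char0Field c ℓ) (n : ℕ) where
  open Char0Field F
  open CommutativeRing cring hiding (zero)
  open Exterior F
  open En n
  open Coefficients F
  open Tau F n
  open CommutativeSemigroupProperties +-commutativeSemigroup using () renaming (interchange to +-interchange)
  open import Relation.Binary.Reasoning.Setoid setoid

  recip : ℕ → Carrier
  recip j = proj₁ (inverse (natCast cring (suc j)) (char0 j))

  recip-inverse : ∀ j → natCast cring (suc j) * recip j ≈ 1#
  recip-inverse j = proj₂ (inverse (natCast cring (suc j)) (char0 j))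

  recip-0 : recip 0 ≈ 1#
  recip-0 = begin
    recip 0              ≈⟨ sym (*-identityˡ _) ⟩
    1# * recip 0         ≈⟨ *-congʳ (sym (+-identityʳ 1#)) ⟩
    (1# + 0#) * recip 0  ≈⟨ recip-inverse 0 ⟩
    1#                   ∎

  τ[_] : ℕ → E → E
  τ[ zero ] h = h
  τ[ suc j ] h = recip j ·E τ′ (τ[ j ] h)

  τ[]-cong : ∀ j {f g} → f ≈E g → τ[ j ] f ≈E τ[ j ] g
  τ[]-cong zero f≈g = f≈g
  τ[]-cong (suc j) f≈g W = *-congˡ (τ′-cong (τ[]-cong j f≈g) W)

  τ[]-+ : ∀ j f g → τ[ j ] (f +E g) ≈E (τ[ j ] f +E τ[ j ] g)
  τ[]-+ zero f g W = refl
  τ[]-+ (suc j) f g W = trans (*-congˡ (trans (τ′-cong (τ[]-+ j f g) W) (τ′-+ (τ[ j ] f) (τ[ j ] g) W))) (distribˡ _ _ _)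

  τ[]-* : ∀ j a f → τ[ j ] (a ·E f) ≈E (a ·E τ[ j ] f)
  τ[]-* zero a f W = refl
  τ[]-* (suc j) a f W = begin
    recip j * τ′ (τ[ j ] (a ·E f)) W ≈⟨ *-congˡ (trans (τ′-cong (τ[]-* j a f) W) (τ′-* a (τ[ j ] f) W)) ⟩
    recip j * (a * τ′ (τ[ j ] f) W) ≈⟨ sym (*-assoc _ _ _) ⟩
    (recip j * a) * τ′ (τ[ j ] f) W ≈⟨ *-congʳ (*-comm _ _) ⟩
    (a * recip j) * τ′ (τ[ j ] f) W ≈⟨ *-assoc _ _ _ ⟩
    a * (recip j * τ′ (τ[ j ] f) W) ∎

  τ[]-τ′ : ∀ j h → τ[ j ] (τ′ h) ≈E τ′ (τ[ j ] h)
  τ[]-τ′ zero h W = refl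
  τ[]-τ′ (suc j) h W = trans (*-congˡ (τ′-cong (τ[]-τ′ j h) W)) (sym (τ′-* (recip j) (τ′ (τ[ j ] h)) W))

  τ′-τ[] : ∀ j h → τ′ (τ[ j ] h) ≈E (natCast cring (suc j) ·E τ[ suc j ] h)
  τ′-τ[] j h W = begin
    τ′ (τ[ j ] h) W                                   ≈⟨ sym (*-identityˡ _) ⟩
    1# * τ′ (τ[ j ] h) W                              ≈⟨ *-congʳ (sym (recip-inverse j)) ⟩
    (natCast cring (suc j) * recip j) * τ′ (τ[ j ] h) W ≈⟨ *-assoc _ _ _ ⟩
    natCast cring (suc j) * (recip j * τ′ (τ[ j ] h) W) ∎

  τ[]-vanish : ∀ j h W → αdeg W ℕ.< j → τ[ j ] h W ≈ 0#
  τ[]-vanish = λ j h → vanish-below-αdeg (λ k → τ[ k ] h)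
    (λ k W τk≈0 → trans (*-congˡ (τ′-local-zero (τ[ k ] h) W τk≈0)) (zeroʳ _)) j

  τ[]-mulGen-α : ∀ j a h → τ[ j ] (mulGen (αpos a) h) ≈E mulGen (αpos a) (τ[ j ] h)
  τ[]-mulGen-α zero a h W = refl
  τ[]-mulGen-α (suc j) a h W = begin
    recip j * τ′ (τ[ j ] (mulGen (αpos a) h)) W ≈⟨ *-congˡ (τ′-cong (τ[]-mulGen-α j a h) W) ⟩
    recip j * τ′ (mulGen (αpos a) (τ[ j ] h)) W ≈⟨ *-congˡ (τ′-mulGen-α a (τ[ j ] h) W) ⟩
    recip j * mulGen (αpos a) (τ′ (τ[ j ] h)) W ≈⟨ sym (mulGen-* (αpos a) (recip j) (τ′ (τ[ j ] h)) W) ⟩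
    mulGen (αpos a) (τ[ suc j ] h) W ∎

  τ[]-mulGen-θ : ∀ j b h → τ[ suc j ] (mulGen (θpos b) h) ≈E (mulGen (θpos b) (τ[ suc j ] h) +E mulGen (αpos b) (τ[ j ] h))
  τ[]-mulGen-θ zero b h W = begin
    recip 0 * τ′ (mulGen (θpos b) h) W ≈⟨ *-congˡ (τ′-mulGen-θ b h W) ⟩
    recip 0 * (mulGen (θpos b) (τ′ h) W + mulGen (αpos b) h W) ≈⟨ distribˡ _ _ _ ⟩
    recip 0 * mulGen (θpos b) (τ′ h) W + recip 0 * mulGen (αpos b) h W
      ≈⟨ +-cong (sym (mulGen-* (θpos b) (recip 0) (τ′ h) W)) (trans (*-congʳ recip-0) (*-identityˡ _)) ⟩
    mulGen (θpos b) (τ[ 1 ] h) W + mulGen (αpos b) h W ∎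
  τ[]-mulGen-θ (suc j) b h W = begin
    r * τ′ (τ[ suc j ] (mulGen (θpos b) h)) W
      ≈⟨ *-congˡ (trans (τ′-cong (τ[]-mulGen-θ j b h) W) (τ′-+ (mulGen (θpos b) X) (mulGen (αpos b) Y) W)) ⟩
    r * (τ′ (mulGen (θpos b) X) W + τ′ (mulGen (αpos b) Y) W)
      ≈⟨ *-congˡ (+-cong (τ′-mulGen-θ b X W) (τ′-mulGen-α b Y W)) ⟩
    r * ((mulGen (θpos b) (τ′ X) W + mulGen (αpos b) X W) + mulGen (αpos b) (τ′ Y) W)
      ≈⟨ trans (*-congˡ (+-assoc _ _ _)) (distribˡ _ _ _) ⟩
    r * mulGen (θpos b) (τ′ X) W + r * (mulGen (αpos b) X W + mulGen (αpos b) (τ′ Y) W)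
      ≈⟨ +-cong (sym (mulGen-* (θpos b) r (τ′ X) W)) (*-congˡ α-terms) ⟩
    mulGen (θpos b) (τ[ suc (suc j) ] h) W + r * (natCast cring (suc (suc j)) * mulGen (αpos b) X W)
      ≈⟨ +-congˡ (trans (sym (*-assoc _ _ _)) (trans (*-congʳ (trans (*-comm _ _) (recip-inverse (suc j)))) (*-identityˡ _))) ⟩
    mulGen (θpos b) (τ[ suc (suc j) ] h) W + mulGen (αpos b) X W ∎
    where
    r = recip (suc j)
    X = τ[ suc j ] h
    Y = τ[ j ] h
    α-terms : mulGen (αpos b) X W + mulGen (αpos b) (τ′ Y) W ≈ natCast cring (suc (suc j)) * mulGen (αpos b) X W
    α-terms = begin
      mulGen (αpos b) X W + mulGen (αpos b) (τ′ Y) W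
        ≈⟨ +-congˡ (trans (mulGen-cong (αpos b) (τ′-τ[] j h) W) (mulGen-* (αpos b) (natCast cring (suc j)) X W)) ⟩
      mulGen (αpos b) X W + natCast cring (suc j) * mulGen (αpos b) X W
        ≈⟨ +-congʳ (sym (*-identityˡ _)) ⟩
      1# * mulGen (αpos b) X W + natCast cring (suc j) * mulGen (αpos b) X W
        ≈⟨ sym (distribʳ _ _ _) ⟩
      natCast cring (suc (suc j)) * mulGen (αpos b) X W ∎

  τ[]-1E : ∀ j → τ[ suc j ] 1E ≈E 0E
  τ[]-1E zero W = trans (*-congˡ (τ′-1E W)) (zeroʳ _)
    where
    ∂-1E : ∀ p → ∂ p 1E ≈E 0E
    ∂-1E p W with lookup W p in p∈W
    ... | true = refl
    ... | false = trans (signed-cong (below p W) (e-offdiag ⊥ (W [ p ]≔ true) (λ eq → false≢true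
                    (P.trans (P.sym (lookup-replicate p false)) (P.trans (P.cong (λ V → lookup V p) eq) (lookup∘update p W true))))))
                  (signed-0# (below p W))
      where
      false≢true : false ≢ true
      false≢true ()
    τ′-1E : τ′ 1E ≈E 0E
    τ′-1E = sumFin-0E (λ i → mulGen (αpos i) (∂ (θpos i) 1E))
      (λ i V → trans (mulGen-cong (αpos i) (∂-1E (θpos i)) V) (mulGen-0E (αpos i) V))
  τ[]-1E (suc j) W = trans (*-congˡ (trans (τ′-cong (τ[]-1E j) W) (τ′-0E W))) (zeroʳ _)

  expUpTo : ℕ → E → E
  expUpTo zero h = 0E
  expUpTo (suc N) h = expUpTo N h +E τ[ N ] h

  expUpTo-cong : ∀ N {f g} → f ≈E g → expUpTo N f ≈E expUpTo N g
  expUpTo-cong zero f≈g W = refl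
  expUpTo-cong (suc N) f≈g W = +-cong (expUpTo-cong N f≈g W) (τ[]-cong N f≈g W)

  expUpTo-+ : ∀ N f g → expUpTo N (f +E g) ≈E (expUpTo N f +E expUpTo N g)
  expUpTo-+ zero f g W = sym (+-identityʳ 0#)
  expUpTo-+ (suc N) f g W = trans (+-cong (expUpTo-+ N f g W) (τ[]-+ N f g W)) (+-interchange _ _ _ _)

  expUpTo-* : ∀ N a f → expUpTo N (a ·E f) ≈E (a ·E expUpTo N f)
  expUpTo-* zero a f W = sym (zeroʳ a)
  expUpTo-* (suc N) a f W = trans (+-cong (expUpTo-* N a f W) (τ[]-* N a f W)) (sym (distribˡ a _ _))

  expUpTo-1E : ∀ N → expUpTo (suc N) 1E ≈E 1E
  expUpTo-1E zero W = +-identityˡ _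
  expUpTo-1E (suc N) W = trans (+-cong (expUpTo-1E N W) (τ[]-1E N W)) (+-identityʳ _)

  expUpTo-mulGen-α : ∀ N a h → expUpTo N (mulGen (αpos a) h) ≈E mulGen (αpos a) (expUpTo N h)
  expUpTo-mulGen-α zero a h W = sym (mulGen-0E (αpos a) W)
  expUpTo-mulGen-α (suc N) a h W =
    trans (+-cong (expUpTo-mulGen-α N a h W) (τ[]-mulGen-α N a h W)) (sym (mulGen-+ (αpos a) (expUpTo N h) (τ[ N ] h) W))

  expUpTo-mulGen-θ : ∀ N b h →
    expUpTo (suc N) (mulGen (θpos b) h) ≈E (mulGen (θpos b) (expUpTo (suc N) h) +E mulGen (αpos b) (expUpTo N h))
  expUpTo-mulGen-θ zero b h W = begin
    0# + mulGen (θpos b) h W ≈⟨ +-comm _ _ ⟩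
    mulGen (θpos b) h W + 0# ≈⟨ +-cong (mulGen-cong (θpos b) (λ V → sym (+-identityˡ (h V))) W) (sym (mulGen-0E (αpos b) W)) ⟩
    mulGen (θpos b) (0E +E h) W + mulGen (αpos b) 0E W ∎
  expUpTo-mulGen-θ (suc N) b h W = begin
    expUpTo (suc N) (mulGen (θpos b) h) W + τ[ suc N ] (mulGen (θpos b) h) W
      ≈⟨ +-cong (expUpTo-mulGen-θ N b h W) (τ[]-mulGen-θ N b h W) ⟩
    (mulGen (θpos b) (expUpTo (suc N) h) W + mulGen (αpos b) (expUpTo N h) W)
      + (mulGen (θpos b) (τ[ suc N ] h) W + mulGen (αpos b) (τ[ N ] h) W)
      ≈⟨ +-interchange _ _ _ _ ⟩
    (mulGen (θpos b) (expUpTo (suc N) h) W + mulGen (θpos b) (τ[ suc N ] h) W)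
      + (mulGen (αpos b) (expUpTo N h) W + mulGen (αpos b) (τ[ N ] h) W)
      ≈⟨ sym (+-cong (mulGen-+ (θpos b) (expUpTo (suc N) h) (τ[ suc N ] h) W) (mulGen-+ (αpos b) (expUpTo N h) (τ[ N ] h) W)) ⟩
    mulGen (θpos b) (expUpTo (suc (suc N)) h) W + mulGen (αpos b) (expUpTo (suc N) h) W ∎

  -- τ[ j ] = 0 for j > n, so expτ is all of exp τ; the term beyond the last nonzero one makes the θ-rule close up
  expτ : E → E
  expτ = expUpTo (suc (suc n))

  expτ≈expUpTo-1+n : ∀ h → expτ h ≈E expUpTo (suc n) h
  expτ≈expUpTo-1+n h W = trans (+-congˡ (τ[]-vanish (suc n) h W (s≤s (αdeg≤n W)))) (+-identityʳ _)

  αpos-or-θpos : ∀ p → Σ (Fin n) (λ i → p ≡ αpos i) ⊎ Σ (Fin n) (λ i → p ≡ θpos i)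
  αpos-or-θpos p with Fin.splitAt n p in split≡
  ... | inj₁ i = inj₁ (i , P.sym (splitAt⁻¹-↑ˡ split≡))
  ... | inj₂ i = inj₂ (i , P.sym (splitAt⁻¹-↑ʳ split≡))

  expτ-gen-∧ : ∀ p h → expτ (gen p ∧ h) ≈E (Tgen p ∧ expτ h)
  expτ-gen-∧ p h with αpos-or-θpos p
  ... | inj₁ (i , P.refl) rewrite splitAt-↑ˡ n i n = λ W → begin
    expτ (gen (αpos i) ∧ h) W       ≈⟨ expUpTo-cong (suc (suc n)) (gen-∧ (αpos i) h) W ⟩
    expτ (mulGen (αpos i) h) W      ≈⟨ expUpTo-mulGen-α (suc (suc n)) i h W ⟩
    mulGen (αpos i) (expτ h) W      ≈⟨ sym (gen-∧ (αpos i) (expτ h) W) ⟩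
    (gen (αpos i) ∧ expτ h) W       ∎
  ... | inj₂ (i , P.refl) rewrite splitAt-↑ʳ n n i = λ W → begin
    expτ (gen (θpos i) ∧ h) W       ≈⟨ expUpTo-cong (suc (suc n)) (gen-∧ (θpos i) h) W ⟩
    expτ (mulGen (θpos i) h) W      ≈⟨ expUpTo-mulGen-θ (suc n) i h W ⟩
    mulGen (θpos i) (expτ h) W + mulGen (αpos i) (expUpTo (suc n) h) W
      ≈⟨ +-congˡ (mulGen-cong (αpos i) (λ V → sym (expτ≈expUpTo-1+n h V)) W) ⟩
    mulGen (θpos i) (expτ h) W + mulGen (αpos i) (expτ h) W
      ≈⟨ sym (+-cong (gen-∧ (θpos i) (expτ h) W) (gen-∧ (αpos i) (expτ h) W)) ⟩
    (θ i ∧ expτ h) W + (α i ∧ expτ h) W ≈⟨ sym (∧-distribʳ (θ i) (α i) (expτ h) W) ⟩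
    ((θ i +E α i) ∧ expτ h) W       ∎

  expτ-prodOver : ∀ {m} (g g′ : Fin m → E) → (∀ k h → expτ (g k ∧ h) ≈E (g′ k ∧ expτ h)) →
    ∀ S → expτ (prodOver g S) ≈E prodOver g′ S
  expτ-prodOver g g′ expτ-g [] = expUpTo-1E (suc n)
  expτ-prodOver g g′ expτ-g (true ∷ S) W = trans (expτ-g zero (prodOver (λ k → g (suc k)) S) W)
    (∧-congʳ (g′ zero) (expτ-prodOver (λ k → g (suc k)) (λ k → g′ (suc k)) (λ k → expτ-g (suc k)) S) W)
  expτ-prodOver g g′ expτ-g (false ∷ S) = expτ-prodOver (λ k → g (suc k)) (λ k → g′ (suc k)) (λ k → expτ-g (suc k)) S

  expτ-sumSub : ∀ {m} (a : Subset m → Carrier) (b : Subset m → E) →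
    expτ (λ V → sumSub (λ S → a S * b S V)) ≈E (λ W → sumSub (λ S → a S * expτ (b S) W))
  expτ-sumSub {zero} a b = expUpTo-* (suc (suc n)) (a []) (b [])
  expτ-sumSub {suc m} a b W = trans
    (expUpTo-+ (suc (suc n)) (λ V → sumSub (λ S → a (false ∷ S) * b (false ∷ S) V))
                             (λ V → sumSub (λ S → a (true ∷ S) * b (true ∷ S) V)) W)
    (+-cong (expτ-sumSub (λ S → a (false ∷ S)) (λ S → b (false ∷ S)) W)
            (expτ-sumSub (λ S → a (true ∷ S)) (λ S → b (true ∷ S)) W))

  T≈expτ : ∀ f → T f ≈E expτ f
  T≈expτ f W = sym (begin
    expτ f W                                              ≈⟨ expUpTo-cong (suc (suc n)) expansion W ⟩
    expτ (λ V → sumSub (λ S → f S * prodOver gen S V)) W  ≈⟨ expτ-sumSub f (prodOver gen) W ⟩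
    sumSub (λ S → f S * expτ (prodOver gen S) W)
      ≈⟨ sumSub-cong (λ S → *-congˡ (expτ-prodOver gen Tgen expτ-gen-∧ S W)) ⟩
    T f W                                                 ∎)
    where
    expansion : f ≈E (λ V → sumSub (λ S → f S * prodOver gen S V))
    expansion V = sym (begin
      sumSub (λ S → f S * prodOver gen S V) ≈⟨ sumSub-cong (λ S → *-congˡ (prodOver-gen S V)) ⟩
      sumSub (λ S → f S * e S V)
        ≈⟨ sumSub-δ (λ S → f S * e S V) V (λ S S≢V → trans (*-congˡ (e-offdiag S V S≢V)) (zeroʳ _)) ⟩
      f V * e V V                           ≈⟨ trans (*-congˡ (e-diag V)) (*-identityʳ _) ⟩
      f V                                   ∎)

module Image {c ℓ} (F : Char0Field c ℓ) (n : ℕ) where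
  open Char0Field F
  open CommutativeRing cring hiding (zero)
  open Exterior F
  open En n
  open Coefficients F
  open Tau F n
  open Exponential F n
  open RingProperties ring using (-‿involutive; -0#≈0#; -‿+-comm; -‿distribˡ-*)
  open AbelianGroupProperties +-abelianGroup using (xyx⁻¹≈y)
  open CommutativeSemigroupProperties +-commutativeSemigroup using () renaming (interchange to +-interchange)
  open import Relation.Binary.Reasoning.Setoid setoid

  -- φ N is the truncation of (eˣ − 1)/x = Σ xʲ/(j+1)! at x = τ
  φ : ℕ → E → E
  φ zero h = 0E
  φ (suc N) h = φ N h +E (recip N ·E τ[ N ] h)

  expUpTo-φ : ∀ N h → expUpTo (suc N) h ≈E (h +E τ′ (φ N h))
  expUpTo-φ zero h W = trans (+-identityˡ _) (sym (trans (+-congˡ (τ′-0E W)) (+-identityʳ _)))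
  expUpTo-φ (suc N) h W = begin
    expUpTo (suc N) h W + recip N * τ′ (τ[ N ] h) W    ≈⟨ +-congʳ (expUpTo-φ N h W) ⟩
    (h W + τ′ (φ N h) W) + recip N * τ′ (τ[ N ] h) W   ≈⟨ +-assoc _ _ _ ⟩
    h W + (τ′ (φ N h) W + recip N * τ′ (τ[ N ] h) W)
      ≈⟨ +-congˡ (trans (+-congˡ (sym (τ′-* (recip N) (τ[ N ] h) W))) (sym (τ′-+ (φ N h) (recip N ·E τ[ N ] h) W))) ⟩
    h W + τ′ (φ (suc N) h) W                           ∎

  T-id≈τ′φ : ∀ f → (T f -E f) ≈E τ′ (φ (suc n) f)
  T-id≈τ′φ f W = begin
    T f W - f W                         ≈⟨ +-congʳ (trans (T≈expτ f W) (expUpTo-φ (suc n) f W)) ⟩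
    (f W + τ′ (φ (suc n) f) W) - f W    ≈⟨ xyx⁻¹≈y _ _ ⟩
    τ′ (φ (suc n) f) W                  ∎

  T-image⊆τ-image : ∀ g → Σ E (λ f → g ≈E (T f -E f)) → Σ E (λ f → g ≈E τ f)
  T-image⊆τ-image g (f , g≈Tf-f) = φ (suc n) f , λ W →
    trans (g≈Tf-f W) (trans (T-id≈τ′φ f W) (sym (τ≈τ′ (φ (suc n) f) W)))

  -- ψ N truncates (eˣ − 1 − x)/x² = Σ xʲ/(j+2)!, so that φ (N+1) = 1 + τ ψ N
  ψ : ℕ → E → E
  ψ zero h = 0E
  ψ (suc N) h = ψ N h +E ((recip (suc N) * recip N) ·E τ[ N ] h)

  φ-ψ : ∀ N h → φ (suc N) h ≈E (h +E τ′ (ψ N h))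
  φ-ψ zero h W = trans (+-identityˡ _) (trans (trans (*-congʳ recip-0) (*-identityˡ _))
                   (sym (trans (+-congˡ (τ′-0E W)) (+-identityʳ _))))
  φ-ψ (suc N) h W = begin
    φ (suc N) h W + recip (suc N) * (recip N * τ′ (τ[ N ] h) W)
      ≈⟨ +-cong (φ-ψ N h W) (sym (*-assoc _ _ _)) ⟩
    (h W + τ′ (ψ N h) W) + r * τ′ (τ[ N ] h) W ≈⟨ +-assoc _ _ _ ⟩
    h W + (τ′ (ψ N h) W + r * τ′ (τ[ N ] h) W)
      ≈⟨ +-congˡ (trans (+-congˡ (sym (τ′-* r (τ[ N ] h) W))) (sym (τ′-+ (ψ N h) (r ·E τ[ N ] h) W))) ⟩
    h W + τ′ (ψ (suc N) h) W ∎
    where r = recip (suc N) * recip N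

  T-id≈τ′+τ′τ′ψ : ∀ x → (T x -E x) ≈E (τ′ x +E τ′ (τ′ (ψ n x)))
  T-id≈τ′+τ′τ′ψ x W = trans (T-id≈τ′φ x W) (trans (τ′-cong (φ-ψ n x) W) (τ′-+ x (τ′ (ψ n x)) W))

  ψ-τ′ : ∀ N h → ψ N (τ′ h) ≈E τ′ (ψ N h)
  ψ-τ′ zero h W = sym (τ′-0E W)
  ψ-τ′ (suc N) h W = begin
    ψ N (τ′ h) W + r * τ[ N ] (τ′ h) W ≈⟨ +-cong (ψ-τ′ N h W) (*-congˡ (τ[]-τ′ N h W)) ⟩
    τ′ (ψ N h) W + r * τ′ (τ[ N ] h) W ≈⟨ +-congˡ (sym (τ′-* r (τ[ N ] h) W)) ⟩
    τ′ (ψ N h) W + τ′ (r ·E τ[ N ] h) W ≈⟨ sym (τ′-+ (ψ N h) (r ·E τ[ N ] h) W) ⟩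
    τ′ (ψ (suc N) h) W ∎
    where r = recip (suc N) * recip N

  τ′^ : ℕ → E → E
  τ′^ zero h = h
  τ′^ (suc k) h = τ′ (τ′^ k h)

  ψ-τ′^ : ∀ k h → ψ n (τ′^ k h) ≈E τ′^ k (ψ n h)
  ψ-τ′^ zero h W = refl
  ψ-τ′^ (suc k) h W = trans (ψ-τ′ n (τ′^ k h) W) (τ′-cong (ψ-τ′^ k h) W)

  τ′^-vanish : ∀ k h W → αdeg W ℕ.< k → τ′^ k h W ≈ 0#
  τ′^-vanish k h = vanish-below-αdeg (λ j → τ′^ j h) (λ j → τ′-local-zero (τ′^ j h)) k

  T-0E : T 0E ≈E 0E
  T-0E W = sumSub-0# (λ S → zeroˡ (prodOver Tgen S W))

  T--E : ∀ x y → T (x -E y) ≈E (T x -E T y)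
  T--E x y W = begin
    sumSub (λ S → (x S - y S) * prodOver Tgen S W)
      ≈⟨ sumSub-cong (λ S → trans (distribʳ (prodOver Tgen S W) (x S) (- y S)) (+-congˡ (sym (-‿distribˡ-* (y S) _)))) ⟩
    sumSub (λ S → x S * prodOver Tgen S W + - (y S * prodOver Tgen S W))
      ≈⟨ sumSub-+ (λ S → x S * prodOver Tgen S W) (λ S → - (y S * prodOver Tgen S W)) ⟩
    T x W + sumSub (λ S → - (y S * prodOver Tgen S W)) ≈⟨ +-congˡ (sumSub-‿ (λ S → y S * prodOver Tgen S W)) ⟩
    T x W - T y W ∎

  τ′^-in-T-image-step : ∀ k → (∀ h → Σ E (λ x → τ′^ (suc (suc k)) h ≈E (T x -E x))) →
    ∀ h → Σ E (λ x → τ′^ (suc k) h ≈E (T x -E x))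
  τ′^-in-T-image-step k higher h = (x₀ -E y) , λ W → sym (begin
    T (x₀ -E y) W - (x₀ W - y W)             ≈⟨ +-congʳ (T--E x₀ y W) ⟩
    (T x₀ W - T y W) - (x₀ W - y W)          ≈⟨ sub-interchange _ _ _ _ ⟩
    (T x₀ W - x₀ W) - (T y W - y W)
      ≈⟨ +-cong (T-id≈τ′+τ′τ′ψ x₀ W) (-‿cong (sym (proj₂ (higher (ψ n h)) W))) ⟩
    (τ′ x₀ W + τ′ (τ′ (ψ n x₀)) W) - τ′^ (suc (suc k)) (ψ n h) W
      ≈⟨ +-congʳ (+-congˡ (τ′-cong (τ′-cong (ψ-τ′^ k h)) W)) ⟩
    (τ′ x₀ W + τ′^ (suc (suc k)) (ψ n h) W) - τ′^ (suc (suc k)) (ψ n h) W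
      ≈⟨ trans (+-congʳ (+-comm _ _)) (xyx⁻¹≈y _ _) ⟩
    τ′^ (suc k) h W ∎)
    where
    x₀ = τ′^ k h
    y = proj₁ (higher (ψ n h))
    sub-interchange : ∀ a b c d → (a - b) - (c - d) ≈ (a - c) - (b - d)
    sub-interchange a b c d = begin
      (a - b) - (c - d)   ≈⟨ +-congˡ (trans (sym (-‿+-comm c (- d))) (+-congˡ (-‿involutive d))) ⟩
      (a - b) + (- c + d) ≈⟨ +-interchange a (- b) (- c) d ⟩
      (a - c) + (- b + d) ≈⟨ +-congˡ (trans (+-congˡ (sym (-‿involutive d))) (-‿+-comm b (- d))) ⟩
      (a - c) - (b - d)   ∎

  τ′^-in-T-image : ∀ d k → n ℕ.≤ k ℕ.+ d → ∀ h → Σ E (λ x → τ′^ (suc k) h ≈E (T x -E x))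
  τ′^-in-T-image zero k n≤k h = 0E , λ W →
    trans (τ′^-vanish (suc k) h W (s≤s (ℕ.≤-trans (αdeg≤n W) (ℕ.≤-trans n≤k (ℕ.≤-reflexive (ℕ.+-identityʳ k))))))
          (sym (trans (+-cong (T-0E W) -0#≈0#) (+-identityʳ 0#)))
  τ′^-in-T-image (suc d) k n≤k+1+d =
    τ′^-in-T-image-step k (τ′^-in-T-image d (suc k) (ℕ.≤-trans n≤k+1+d (ℕ.≤-reflexive (ℕ.+-suc k d))))

  τ-image⊆T-image : ∀ g → Σ E (λ f → g ≈E τ f) → Σ E (λ f → g ≈E (T f -E f))
  τ-image⊆T-image g (f , g≈τf) = proj₁ preimage , λ W → trans (g≈τf W) (trans (τ≈τ′ f W) (proj₂ preimage W))
    where preimage = τ′^-in-T-image n 0 ℕ.≤-refl f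

module Bigrading {c ℓ} (F : Char0Field c ℓ) (n : ℕ) where
  open Char0Field F
  open CommutativeRing cring hiding (zero)
  open Exterior F
  open En n
  open Tau F n

  bideg? : ∀ i j W → Dec (αdeg W ≡ i × θdeg W ≡ j)
  bideg? i j W = (αdeg W ≟ℕ i) ×-dec (θdeg W ≟ℕ j)

  proj-∈ : ∀ {i j} f W → αdeg W ≡ i → θdeg W ≡ j → proj i j f W ≈ f W
  proj-∈ f W P.refl P.refl
    rewrite dec-true (card (take n W) ≟ℕ card (take n W)) P.refl | dec-true (card (drop n W) ≟ℕ card (drop n W)) P.refl = refl

  proj-∉ : ∀ {i j} f W → ¬ (αdeg W ≡ i × θdeg W ≡ j) → proj i j f W ≈ 0#
  proj-∉ {i} {j} f W ¬ij with card (take n W) ≟ℕ i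
  ... | no αW≢i rewrite dec-false (card (take n W) ≟ℕ i) αW≢i = refl
  ... | yes αW≡i rewrite dec-true (card (take n W) ≟ℕ i) αW≡i
                       | dec-false (card (drop n W) ≟ℕ j) (λ θW≡j → ¬ij (αW≡i , θW≡j)) = refl

  proj-cong : ∀ {i j f g} → f ≈E g → proj i j f ≈E proj i j g
  proj-cong {i} {j} f≈g W with does (card (take n W) ≟ℕ i) Bool.∧ does (card (drop n W) ≟ℕ j)
  ... | true = f≈g W
  ... | false = refl

  proj-idem : ∀ i j f → Bihom i j (proj i j f)
  proj-idem i j f W with does (card (take n W) ≟ℕ i) Bool.∧ does (card (drop n W) ≟ℕ j)
  ... | true = refl
  ... | false = refl

  τ-cong : ∀ {f g} → f ≈E g → τ f ≈E τ g
  τ-cong {f} {g} f≈g W = trans (τ≈τ′ f W) (trans (τ′-cong f≈g W) (sym (τ≈τ′ g W)))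

  ⇝-bideg : ∀ {i j V W} → V ⇝ W → αdeg V ≡ i × θdeg V ≡ suc j → αdeg W ≡ suc i × θdeg W ≡ j
  ⇝-bideg (αV⇝αW , θV⇝θW) (αV≡i , θV≡1+j) =
    P.trans (P.sym αV⇝αW) (P.cong suc αV≡i) , ℕ.suc-injective (P.trans (P.sym θV⇝θW) θV≡1+j)

  ⇝-bideg⁻¹ : ∀ {i j V W} → V ⇝ W → αdeg W ≡ suc i × θdeg W ≡ j → αdeg V ≡ i × θdeg V ≡ suc j
  ⇝-bideg⁻¹ (αV⇝αW , θV⇝θW) (αW≡1+i , θW≡j) =
    ℕ.suc-injective (P.trans αV⇝αW αW≡1+i) , P.trans θV⇝θW (P.cong suc θW≡j)

  τ-proj : ∀ i j f → τ (proj i (suc j) f) ≈E proj (suc i) j (τ f)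
  τ-proj i j f W with bideg? (suc i) j W
  ... | yes (αW≡1+i , θW≡j) = trans (τ≈τ′ (proj i (suc j) f) W) (trans
          (τ′-local (proj i (suc j) f) f W (λ V V⇝W →
            let (αV≡i , θV≡1+j) = ⇝-bideg⁻¹ V⇝W (αW≡1+i , θW≡j) in proj-∈ f V αV≡i θV≡1+j))
          (sym (trans (proj-∈ (τ f) W αW≡1+i θW≡j) (τ≈τ′ f W))))
  ... | no ¬ij = trans (τ≈τ′ (proj i (suc j) f) W) (trans
          (τ′-local-zero (proj i (suc j) f) W (λ V V⇝W → proj-∉ f V (λ ij → ¬ij (⇝-bideg V⇝W ij))))
          (sym (proj-∉ (τ f) W ¬ij)))

  τ-proj-0 : ∀ j f → proj 0 j (τ f) ≈E 0E
  τ-proj-0 j f W with bideg? 0 j W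
  ... | yes (αW≡0 , θW≡j) = trans (proj-∈ (τ f) W αW≡0 θW≡j) (trans (τ≈τ′ f W)
          (τ′-local-zero f W (λ V (αV⇝αW , _) → ⊥-elim (ℕ.1+n≢0 (P.trans αV⇝αW αW≡0)))))
  ... | no ¬ij = proj-∉ (τ f) W ¬ij

  τ-bihomogeneous : ∀ i j f → Bihom i (suc j) f → Bihom (suc i) j (τ f)
  τ-bihomogeneous i j f f-hom W = trans (τ-cong f-hom W) (τ-proj i j f W)

  τ-image-components : ∀ g → Σ E (λ f → g ≈E τ f) →
    (∀ j → proj 0 j g ≈E 0E) × (∀ i j → Σ E (λ f → Bihom i (suc j) f × (τ f ≈E proj (suc i) j g)))
  τ-image-components g (f , g≈τf) =
    (λ j W → trans (proj-cong g≈τf W) (τ-proj-0 j f W)) ,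
    (λ i j → proj i (suc j) f , proj-idem i (suc j) f , λ W → trans (τ-proj i j f W) (sym (proj-cong g≈τf W)))

  τ-image-from-components : ∀ g →
    (∀ j → proj 0 j g ≈E 0E) × (∀ i j → Σ E (λ f → Bihom i (suc j) f × (τ f ≈E proj (suc i) j g))) →
    Σ E (λ f → g ≈E τ f)
  τ-image-from-components g (g₀≈0 , component) = glued , g≈τ-glued
    where
    piece : ℕ → ℕ → E
    piece i zero = 0E
    piece i (suc j) = proj₁ (component i j)
    glued : E
    glued V = piece (αdeg V) (θdeg V) V
    proj-glued : ∀ i j → proj i (suc j) (piece i (suc j)) ≈E proj i (suc j) glued
    proj-glued i j V with bideg? i (suc j) V
    ... | yes (P.refl , θV≡1+j) = trans (proj-∈ (piece (αdeg V) (suc j)) V P.refl θV≡1+j)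
          (trans (reflexive (P.cong (λ k → piece (αdeg V) k V) (P.sym θV≡1+j))) (sym (proj-∈ glued V P.refl θV≡1+j)))
    ... | no ¬ij = trans (proj-∉ (piece i (suc j)) V ¬ij) (sym (proj-∉ glued V ¬ij))
    g≈τ-glued : ∀ W → g W ≈ τ glued W
    g≈τ-glued W with αdeg W in αW≡
    ... | zero = trans (sym (proj-∈ g W αW≡ P.refl))
          (trans (g₀≈0 (θdeg W) W) (sym (trans (sym (proj-∈ (τ glued) W αW≡ P.refl)) (τ-proj-0 (θdeg W) glued W))))
    ... | suc a = begin
      g W                                  ≈⟨ sym (proj-∈ g W αW≡ P.refl) ⟩
      proj (suc a) j g W                   ≈⟨ sym (proj₂ (proj₂ (component a j)) W) ⟩
      τ (piece a (suc j)) W                ≈⟨ τ-cong (proj₁ (proj₂ (component a j))) W ⟩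
      τ (proj a (suc j) (piece a (suc j))) W ≈⟨ τ-cong (proj-glued a j) W ⟩
      τ (proj a (suc j) glued) W           ≈⟨ τ-proj a j glued W ⟩
      proj (suc a) j (τ glued) W           ≈⟨ proj-∈ (τ glued) W αW≡ P.refl ⟩
      τ glued W                            ∎
      where
      j = θdeg W
      open import Relation.Binary.Reasoning.Setoid setoid

proposition3p6 : ∀ {c ℓ} (F : Char0Field c ℓ) (n : ℕ) → 1 ≤ n →
    let open Exterior F in
    let open En n in
    -- { T f - f : f ∈ E_n } = τ(E_n)
    ((g : E) → Σ E (λ f → g ≈E (T f -E f)) → Σ E (λ f → g ≈E τ f))
    × ((g : E) → Σ E (λ f → g ≈E τ f) → Σ E (λ f → g ≈E (T f -E f)))
    -- τ is bihomogeneous of bidegree (1,-1): τ((E_n)_{i,j+1}) ⊆ (E_n)_{i+1,j}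
    × ((i j : ℕ) (f : E) → Bihom i (suc j) f → Bihom (suc i) j (τ f))
    -- the image is bigraded: g ∈ τ(E_n) iff each component g_{i,j} ∈ τ((E_n)_{i-1,j+1})
    -- (with (E_n)_{i-1,*} = 0 when i = 0), so E_n/τ(E_n) = ⊕_{i,j} (E_n)_{i,j}/τ((E_n)_{i-1,j+1})
    × ((g : E) →
        (Σ E (λ f → g ≈E τ f))
        → (((j : ℕ) → proj 0 j g ≈E 0E)
           × ((i j : ℕ) → Σ E (λ f → Bihom i (suc j) f × (τ f ≈E proj (suc i) j g)))))
    × ((g : E) →
        (((j : ℕ) → proj 0 j g ≈E 0E)
         × ((i j : ℕ) → Σ E (λ f → Bihom i (suc j) f × (τ f ≈E proj (suc i) j g))))
        → Σ E (λ f → g ≈E τ f))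
proposition3p6 F n _ =
  T-image⊆τ-image , τ-image⊆T-image , τ-bihomogeneous , τ-image-components , τ-image-from-components
  where
  open Image F n
  open Bigrading F n
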